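{- The reduced suspension defines a functor $\Sigma_r:\mathrm{Syn}(\mathsf{MCaTT})\to\mathrm{Syn}(\mathsf{CaTT})$.
   Context: $\mathsf{CaTT}$ is the Finster–Mimram type theory for weak $\omega$-categories (types $\star$, $\mathrm{Hom}_Atu$; terms variables, $\mathsf{op}_{\Theta,A}[\gamma]$, $\mathsf{coh}_{\Theta,A}[\gamma]$ for ps-contexts $\Theta$). $\mathsf{MCaTT}$ is the type theory with a unit type $\mathbb{1}$ (constant $()$, $\eta$-rule), types $\mathrm{Hom}_Atu$ ($\star$ abbreviating $\mathrm{Hom}_{\mathbb{1}}()()$), and term constructors $\mathsf{mop}_{\Theta,A}[\gamma]$, $\mathsf{mcoh}_{\Theta,A}[\gamma]$. $\mathrm{Syn}(T)$ is the syntactic category (contexts and substitutions up to definitional equality). The reduced suspension $\Sigma_r$, defined on derivable $\mathsf{MCaTT}$ expressions in normal form using a fresh variable $\bullet$, is given by $\Sigma_r\emptyset=(\bullet:\star)$, $\Sigma_r(\Gamma,x:\mathbb{1})=\Sigma_r\Gamma$, $\Sigma_r(\Gamma,x:A)=(\Sigma_r\Gamma,x:\Sigma_rA)$ for $A\neq\mathbb{1}$; $\Sigma_r\mathbb{1}=\star$, $\Sigma_r\star=\mathrm{Hom}_\star\bullet\bullet$, $\Sigma_r(\mathrm{Hom}_Atu)=\mathrm{Hom}_{\Sigma_rA}(\Sigma_rt)(\Sigma_ru)$; $\Sigma_r()=\bullet$, $\Sigma_rx=x$ for variables of type $\neq\mathbb{1}$, $\Sigma_r(\mathsf{mop}_{\Theta,A}[\gamma])=\mathsf{op}_{\Theta,A}[\bullet_\Theta\circ\Sigma_r\gamma]$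 (similarly $\mathsf{mcoh}\mapsto\mathsf{coh}$), where $\bullet_\Theta$ sends variables of type $\star$ to $\bullet$ and other variables to themselves; $\Sigma_r\langle\rangle=\langle\bullet\mapsto\bullet\rangle$, $\Sigma_r\langle\gamma,x\mapsto t\rangle=\Sigma_r\gamma$ if $x$ has type $\mathbb{1}$ and $\langle\Sigma_r\gamma,x\mapsto\Sigma_rt\rangle$ otherwise. It preserves derivability and satisfies $\Sigma_r(\delta\circ\gamma)=\Sigma_r\delta\circ\Sigma_r\gamma$. -}

module Defs where

open import Data.Nat using (ℕ; zero; suc; _∸_; _⊔_; _<ᵇ_; _≡ᵇ_)
open import Data.Bool using (Bool; true; false; if_then_else_)
open import Data.List using (List; []; _∷_; _++_)
open import Data.List.Membership.Propositional using (_∈_; _∉_)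
open import Data.Maybe using (Maybe; just; nothing)
open import Data.Product using (_×_)
open import Data.Empty using (⊥)
open import Relation.Binary.PropositionalEquality using (_≡_)

Name : Set
Name = ℕ

_≋_ : List Name → List Name → Set
L ≋ M = ∀ x → (x ∈ L → x ∈ M) × (x ∈ M → x ∈ L)

infixl 5 _,_∶_
infixl 5 ⟨_,_↦_⟩

mutual
  data Ty : Set where
    ⋆   : Ty
    Hom : Ty → Tm → Tm → Ty

  data Tm : Set where
    var : Name → Tm
    op  : Ctx → Ty → Sub → Tm
    coh : Ctx → Ty → Sub → Tm

  data Ctx : Set where
    ∅     : Ctx
    _,_∶_ : Ctx → Name → Ty → Ctx

  data Sub : Set where
    ⟨⟩      : Sub
    ⟨_,_↦_⟩ : Sub → Name → Tm → Sub

dom : Ctx → List Name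
dom ∅ = []
dom (Γ , x ∶ A) = x ∷ dom Γ

lookupSub : Sub → Name → Tm
lookupSub ⟨⟩ x = var x
lookupSub ⟨ γ , y ↦ t ⟩ x = if x ≡ᵇ y then t else lookupSub γ x

lookupCtx : Ctx → Name → Maybe Ty
lookupCtx ∅ x = nothing
lookupCtx (Γ , y ∶ A) x = if x ≡ᵇ y then just A else lookupCtx Γ x

-- application of a substitution and composition (δ ∘ γ = δ[γ])
mutual
  _[_]Tm : Tm → Sub → Tm
  var x [ σ ]Tm = lookupSub σ x
  op Θ A γ [ σ ]Tm = op Θ A (γ ∘ σ)
  coh Θ A γ [ σ ]Tm = coh Θ A (γ ∘ σ)

  _∘_ : Sub → Sub → Sub
  ⟨⟩ ∘ σ = ⟨⟩
  ⟨ δ , x ↦ t ⟩ ∘ σ = ⟨ δ ∘ σ , x ↦ t [ σ ]Tm ⟩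

_[_]Ty : Ty → Sub → Ty
⋆ [ σ ]Ty = ⋆
Hom A t u [ σ ]Ty = Hom (A [ σ ]Ty) (t [ σ ]Tm) (u [ σ ]Tm)

idSub : Ctx → Sub
idSub ∅ = ⟨⟩
idSub (Γ , x ∶ A) = ⟨ idSub Γ , x ↦ var x ⟩

mutual
  FVTm : Tm → List Name
  FVTm (var x) = x ∷ []
  FVTm (op Θ A γ) = FVSub γ
  FVTm (coh Θ A γ) = FVSub γ

  FVSub : Sub → List Name
  FVSub ⟨⟩ = []
  FVSub ⟨ γ , x ↦ t ⟩ = FVSub γ ++ FVTm t

FVTy : Ty → List Name
FVTy ⋆ = []
FVTy (Hom A t u) = FVTy A ++ FVTm t ++ FVTm u

dimTy : Ty → ℕ
dimTy ⋆ = 0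
dimTy (Hom A t u) = suc (dimTy A)

dimCtx : Ctx → ℕ
dimCtx ∅ = 0
dimCtx (Γ , x ∶ A) = dimCtx Γ ⊔ dimTy A

-- Finster–Mimram source and target of a ps-context
dropLast : Ctx → Ctx
dropLast ∅ = ∅
dropLast (Γ , x ∶ A) = Γ

∂⁻_ : ℕ → Ctx → Ctx
∂⁻_ i ∅ = ∅
∂⁻_ i (∅ , x ∶ A) = ∅ , x ∶ A
∂⁻_ i (Γ , y ∶ A , f ∶ B) =
  if i <ᵇ suc (dimTy A) then ∂⁻_ i Γ else (∂⁻_ i Γ , y ∶ A , f ∶ B)

∂⁺_ : ℕ → Ctx → Ctx
∂⁺_ i ∅ = ∅
∂⁺_ i (∅ , x ∶ A) = ∅ , x ∶ A
∂⁺_ i (Γ , y ∶ A , f ∶ B) =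
  if i <ᵇ dimTy A then ∂⁺_ i Γ
  else (if dimTy A ≡ᵇ i then (dropLast (∂⁺_ i Γ) , y ∶ A)
        else (∂⁺_ i Γ , y ∶ A , f ∶ B))

src : Ctx → Ctx
src Θ = ∂⁻_ (dimCtx Θ ∸ 1) Θ

tgt : Ctx → Ctx
tgt Θ = ∂⁺_ (dimCtx Θ ∸ 1) Θ

data _⊢ps_∶_ : Ctx → Name → Ty → Set where
  pss : ∀ x → (∅ , x ∶ ⋆) ⊢ps x ∶ ⋆
  pse : ∀ {Γ x A} y f → Γ ⊢ps x ∶ A → y ∉ dom Γ → f ∉ dom Γ → (y ≡ f → ⊥) →
        (Γ , y ∶ A , f ∶ Hom A (var x) (var y)) ⊢ps f ∶ Hom A (var x) (var y)
  psd : ∀ {Γ f A x y} → Γ ⊢ps f ∶ Hom A (var x) (var y) → Γ ⊢ps y ∶ A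

data _⊢ps : Ctx → Set where
  ps : ∀ {Γ x} → Γ ⊢ps x ∶ ⋆ → Γ ⊢ps

mutual
  data _⊢ : Ctx → Set where
    ∅  : ∅ ⊢
    ext : ∀ {Γ x A} → Γ ⊢ty A → x ∉ dom Γ → (Γ , x ∶ A) ⊢

  data _⊢ty_ : Ctx → Ty → Set where
    ⋆   : ∀ {Γ} → Γ ⊢ → Γ ⊢ty ⋆
    hom : ∀ {Γ A t u} → Γ ⊢ t ∶ A → Γ ⊢ u ∶ A → Γ ⊢ty Hom A t u

  data _⊢_∶_ : Ctx → Tm → Ty → Set where
    var : ∀ {Γ x A} → Γ ⊢ → lookupCtx Γ x ≡ just A → Γ ⊢ var x ∶ A
    op  : ∀ {Γ Θ A γ} → IsOp Θ A → Γ ⊢s γ ∶ Θ → Γ ⊢ op Θ A γ ∶ (A [ γ ]Ty)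
    coh : ∀ {Γ Θ A γ} → IsCoh Θ A → Γ ⊢s γ ∶ Θ → Γ ⊢ coh Θ A γ ∶ (A [ γ ]Ty)

  data _⊢s_∶_ : Ctx → Sub → Ctx → Set where
    ⟨⟩  : ∀ {Γ} → Γ ⊢ → Γ ⊢s ⟨⟩ ∶ ∅
    ext : ∀ {Γ Δ γ x A t} → Γ ⊢s γ ∶ Δ → (Δ , x ∶ A) ⊢ → Γ ⊢ t ∶ (A [ γ ]Ty) →
          Γ ⊢s ⟨ γ , x ↦ t ⟩ ∶ (Δ , x ∶ A)

  -- side conditions of the operation rule (source/target full)
  data IsOp : Ctx → Ty → Set where
    isOp : ∀ {Θ B t u} → Θ ⊢ps → src Θ ⊢ t ∶ B → tgt Θ ⊢ u ∶ B →
           (FVTm t ++ FVTy B) ≋ dom (src Θ) → (FVTm u ++ FVTy B) ≋ dom (tgt Θ) →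
           IsOp Θ (Hom B t u)

  -- side conditions of the coherence rule (both sides full)
  data IsCoh : Ctx → Ty → Set where
    isCoh : ∀ {Θ B t u} → Θ ⊢ps → Θ ⊢ t ∶ B → Θ ⊢ u ∶ B →
            (FVTm t ++ FVTy B) ≋ dom Θ → (FVTm u ++ FVTy B) ≋ dom Θ →
            IsCoh Θ (Hom B t u)

infixl 5 _,ᴹ_∶_
infixl 5 ⟨_,ᴹ_↦_⟩

mutual
  data MTy : Set where
    𝟙    : MTy
    MHom : MTy → MTm → MTm → MTy

  data MTm : Set where
    mvar : Name → MTm
    ⋄    : MTm
    mop  : Ctx → Ty → MSub → MTm
    mcoh : Ctx → Ty → MSub → MTm

  data MSub : Set where
    ⟨⟩ᴹ      : MSub
    ⟨_,ᴹ_↦_⟩ : MSub → Name → MTm → MSub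

data MCtx : Set where
  ∅ᴹ     : MCtx
  _,ᴹ_∶_ : MCtx → Name → MTy → MCtx

-- ⋆ of MCaTT abbreviates Hom_𝟙 () ()
⋆ᴹ : MTy
⋆ᴹ = MHom 𝟙 ⋄ ⋄

mdom : MCtx → List Name
mdom ∅ᴹ = []
mdom (Γ ,ᴹ x ∶ A) = x ∷ mdom Γ

mlookupSub : MSub → Name → MTm
mlookupSub ⟨⟩ᴹ x = mvar x
mlookupSub ⟨ γ ,ᴹ y ↦ t ⟩ x = if x ≡ᵇ y then t else mlookupSub γ x

mlookupCtx : MCtx → Name → Maybe MTy
mlookupCtx ∅ᴹ x = nothing
mlookupCtx (Γ ,ᴹ y ∶ A) x = if x ≡ᵇ y then just A else mlookupCtx Γ x

mutual
  _[_]MTm : MTm → MSub → MTm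
  mvar x [ σ ]MTm = mlookupSub σ x
  ⋄ [ σ ]MTm = ⋄
  mop Θ A γ [ σ ]MTm = mop Θ A (γ ∘ᴹ σ)
  mcoh Θ A γ [ σ ]MTm = mcoh Θ A (γ ∘ᴹ σ)

  _∘ᴹ_ : MSub → MSub → MSub
  ⟨⟩ᴹ ∘ᴹ σ = ⟨⟩ᴹ
  ⟨ δ ,ᴹ x ↦ t ⟩ ∘ᴹ σ = ⟨ δ ∘ᴹ σ ,ᴹ x ↦ t [ σ ]MTm ⟩

_[_]MTy : MTy → MSub → MTy
𝟙 [ σ ]MTy = 𝟙
MHom A t u [ σ ]MTy = MHom (A [ σ ]MTy) (t [ σ ]MTm) (u [ σ ]MTm)

midSub : MCtx → MSub
midSub ∅ᴹ = ⟨⟩ᴹ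
midSub (Γ ,ᴹ x ∶ A) = ⟨ midSub Γ ,ᴹ x ↦ mvar x ⟩

-- CaTT expressions (ps-contexts Θ and their types) read in MCaTT:
-- the CaTT type ⋆ of 0-cells becomes 𝟙
mutual
  TmM : Tm → MTm
  TmM (var x) = mvar x
  TmM (op Θ A γ) = mop Θ A (SubM γ)
  TmM (coh Θ A γ) = mcoh Θ A (SubM γ)

  SubM : Sub → MSub
  SubM ⟨⟩ = ⟨⟩ᴹ
  SubM ⟨ γ , x ↦ t ⟩ = ⟨ SubM γ ,ᴹ x ↦ TmM t ⟩

TyM : Ty → MTy
TyM ⋆ = 𝟙
TyM (Hom A t u) = MHom (TyM A) (TmM t) (TmM u)

CtxM : Ctx → MCtx
CtxM ∅ = ∅ᴹ
CtxM (Γ , x ∶ A) = CtxM Γ ,ᴹ x ∶ TyM A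

mutual
  data _M⊢ : MCtx → Set where
    ∅ᴹ  : ∅ᴹ M⊢
    ext : ∀ {Γ x A} → Γ M⊢ty A → x ∉ mdom Γ → (Γ ,ᴹ x ∶ A) M⊢

  data _M⊢ty_ : MCtx → MTy → Set where
    𝟙   : ∀ {Γ} → Γ M⊢ → Γ M⊢ty 𝟙
    hom : ∀ {Γ A t u} → Γ M⊢ t ∶ A → Γ M⊢ u ∶ A → Γ M⊢ty MHom A t u

  data _M⊢_∶_ : MCtx → MTm → MTy → Set where
    var  : ∀ {Γ x A} → Γ M⊢ → mlookupCtx Γ x ≡ just A → Γ M⊢ mvar x ∶ A
    unit : ∀ {Γ} → Γ M⊢ → Γ M⊢ ⋄ ∶ 𝟙
    mop  : ∀ {Γ Θ A γ} → IsOp Θ A → Γ M⊢s γ ∶ CtxM Θ → Γ M⊢ mop Θ A γ ∶ (TyM A [ γ ]MTy)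
    mcoh : ∀ {Γ Θ A γ} → IsCoh Θ A → Γ M⊢s γ ∶ CtxM Θ → Γ M⊢ mcoh Θ A γ ∶ (TyM A [ γ ]MTy)
    conv : ∀ {Γ t A B} → Γ M⊢ t ∶ A → Γ M⊢ A ≣ty B → Γ M⊢ t ∶ B

  data _M⊢s_∶_ : MCtx → MSub → MCtx → Set where
    ⟨⟩  : ∀ {Γ} → Γ M⊢ → Γ M⊢s ⟨⟩ᴹ ∶ ∅ᴹ
    ext : ∀ {Γ Δ γ x A t} → Γ M⊢s γ ∶ Δ → (Δ ,ᴹ x ∶ A) M⊢ → Γ M⊢ t ∶ (A [ γ ]MTy) →
          Γ M⊢s ⟨ γ ,ᴹ x ↦ t ⟩ ∶ (Δ ,ᴹ x ∶ A)

  data _M⊢_≣ty_ : MCtx → MTy → MTy → Set where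
    refl  : ∀ {Γ A} → Γ M⊢ty A → Γ M⊢ A ≣ty A
    sym   : ∀ {Γ A B} → Γ M⊢ A ≣ty B → Γ M⊢ B ≣ty A
    trans : ∀ {Γ A B C} → Γ M⊢ A ≣ty B → Γ M⊢ B ≣ty C → Γ M⊢ A ≣ty C
    hom   : ∀ {Γ A A' t t' u u'} → Γ M⊢ A ≣ty A' → Γ M⊢ t ≣ t' ∶ A → Γ M⊢ u ≣ u' ∶ A →
            Γ M⊢ MHom A t u ≣ty MHom A' t' u'

  data _M⊢_≣_∶_ : MCtx → MTm → MTm → MTy → Set where
    refl  : ∀ {Γ t A} → Γ M⊢ t ∶ A → Γ M⊢ t ≣ t ∶ A
    sym   : ∀ {Γ t u A} → Γ M⊢ t ≣ u ∶ A → Γ M⊢ u ≣ t ∶ A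
    trans : ∀ {Γ t u v A} → Γ M⊢ t ≣ u ∶ A → Γ M⊢ u ≣ v ∶ A → Γ M⊢ t ≣ v ∶ A
    conv  : ∀ {Γ t u A B} → Γ M⊢ t ≣ u ∶ A → Γ M⊢ A ≣ty B → Γ M⊢ t ≣ u ∶ B
    η     : ∀ {Γ t} → Γ M⊢ t ∶ 𝟙 → Γ M⊢ t ≣ ⋄ ∶ 𝟙
    mop   : ∀ {Γ Θ A γ γ'} → IsOp Θ A → Γ M⊢s γ ≣ γ' ∶ CtxM Θ →
            Γ M⊢ mop Θ A γ ≣ mop Θ A γ' ∶ (TyM A [ γ ]MTy)
    mcoh  : ∀ {Γ Θ A γ γ'} → IsCoh Θ A → Γ M⊢s γ ≣ γ' ∶ CtxM Θ →
            Γ M⊢ mcoh Θ A γ ≣ mcoh Θ A γ' ∶ (TyM A [ γ ]MTy)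

  data _M⊢s_≣_∶_ : MCtx → MSub → MSub → MCtx → Set where
    ⟨⟩  : ∀ {Γ} → Γ M⊢ → Γ M⊢s ⟨⟩ᴹ ≣ ⟨⟩ᴹ ∶ ∅ᴹ
    ext : ∀ {Γ Δ γ γ' x A t t'} → Γ M⊢s γ ≣ γ' ∶ Δ → (Δ ,ᴹ x ∶ A) M⊢ →
          Γ M⊢ t ≣ t' ∶ (A [ γ ]MTy) →
          Γ M⊢s ⟨ γ ,ᴹ x ↦ t ⟩ ≣ ⟨ γ' ,ᴹ x ↦ t' ⟩ ∶ (Δ ,ᴹ x ∶ A)

-- Normal forms: every term of type 𝟙 replaced by ().
-- (The only terms of type 𝟙 are () and variables of type 𝟙.)

is𝟙 : MTy → Bool
is𝟙 𝟙 = true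
is𝟙 (MHom _ _ _) = false

has𝟙 : MCtx → Name → Bool
has𝟙 Γ x with mlookupCtx Γ x
... | just A = is𝟙 A
... | nothing = false

mutual
  nfTm : MCtx → MTm → MTm
  nfTm Γ (mvar x) = if has𝟙 Γ x then ⋄ else mvar x
  nfTm Γ ⋄ = ⋄
  nfTm Γ (mop Θ A γ) = mop Θ A (nfSub Γ (CtxM Θ) γ)
  nfTm Γ (mcoh Θ A γ) = mcoh Θ A (nfSub Γ (CtxM Θ) γ)

  nfSub : MCtx → MCtx → MSub → MSub
  nfSub Γ Δ ⟨⟩ᴹ = ⟨⟩ᴹ
  nfSub Γ Δ ⟨ γ ,ᴹ x ↦ t ⟩ =
    ⟨ nfSub Γ Δ γ ,ᴹ x ↦ (if has𝟙 Δ x then ⋄ else nfTm Γ t) ⟩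

nfTy : MCtx → MTy → MTy
nfTy Γ 𝟙 = 𝟙
nfTy Γ (MHom A t u) = MHom (nfTy Γ A) (nfTm Γ t) (nfTm Γ u)

nfCtx : MCtx → MCtx
nfCtx ∅ᴹ = ∅ᴹ
nfCtx (Γ ,ᴹ x ∶ A) = nfCtx Γ ,ᴹ x ∶ nfTy Γ A

-- Reduced suspension Σ_r on normal forms.
-- Name convention: the fresh variable • is the CaTT name 0, and an MCaTT
-- variable x is renamed to the CaTT name suc x (so • is fresh).

• : Tm
• = var 0

-- •_Θ : Σ_r Θ ⊢ •_Θ : Θ, variables of type ⋆ ↦ •, others ↦ themselves
bulletSub : Ctx → Sub
bulletSub ∅ = ⟨⟩
bulletSub (Θ , x ∶ ⋆) = ⟨ bulletSub Θ , x ↦ • ⟩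
bulletSub (Θ , x ∶ Hom A t u) = ⟨ bulletSub Θ , x ↦ var (suc x) ⟩

mutual
  ΣrTm : MTm → Tm
  ΣrTm (mvar x) = var (suc x)
  ΣrTm ⋄ = •
  ΣrTm (mop Θ A γ) = op Θ A (bulletSub Θ ∘ ΣrSub (CtxM Θ) γ)
  ΣrTm (mcoh Θ A γ) = coh Θ A (bulletSub Θ ∘ ΣrSub (CtxM Θ) γ)

  -- Σ_r of a substitution whose codomain is Δ (used to know which
  -- variables have type 𝟙)
  ΣrSub : MCtx → MSub → Sub
  ΣrSub Δ ⟨⟩ᴹ = ⟨ ⟨⟩ , 0 ↦ • ⟩
  ΣrSub Δ ⟨ γ ,ᴹ x ↦ t ⟩ =
    if has𝟙 Δ x then ΣrSub Δ γ else ⟨ ΣrSub Δ γ , suc x ↦ ΣrTm t ⟩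

ΣrTy : MTy → Ty
ΣrTy 𝟙 = ⋆
ΣrTy (MHom A t u) = Hom (ΣrTy A) (ΣrTm t) (ΣrTm u)

ΣrCtx : MCtx → Ctx
ΣrCtx ∅ᴹ = ∅ , 0 ∶ ⋆
ΣrCtx (Γ ,ᴹ x ∶ A) = if is𝟙 A then ΣrCtx Γ else (ΣrCtx Γ , suc x ∶ ΣrTy A)

Σr₀ : MCtx → Ctx
Σr₀ Γ = ΣrCtx (nfCtx Γ)

Σr₁ : MCtx → MCtx → MSub → Sub
Σr₁ Γ Δ γ = ΣrSub (nfCtx Δ) (nfSub Γ Δ γ)

-- Objects of Syn: derivable contexts; morphisms Γ → Δ: derivable
-- substitutions Γ ⊢ γ : Δ modulo definitional equality (in CaTT this is
-- syntactic equality).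
IsFunctorΣr : Set
IsFunctorΣr =
    (∀ {Γ} → Γ M⊢ → Σr₀ Γ ⊢)
  × (∀ {Γ Δ γ} → Γ M⊢s γ ∶ Δ → Σr₀ Γ ⊢s Σr₁ Γ Δ γ ∶ Σr₀ Δ)
  × (∀ {Γ Δ γ γ'} → Γ M⊢s γ ≣ γ' ∶ Δ → Σr₁ Γ Δ γ ≡ Σr₁ Γ Δ γ')
  × (∀ {Γ} → Γ M⊢ → Σr₁ Γ Γ (midSub Γ) ≡ idSub (Σr₀ Γ))
  × (∀ {Γ Δ Ξ γ δ} → Γ M⊢s γ ∶ Δ → Δ M⊢s δ ∶ Ξ →
       Σr₁ Γ Ξ (δ ∘ᴹ γ) ≡ (Σr₁ Δ Ξ δ ∘ Σr₁ Γ Δ γ))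

-- Σr is computed on normal forms, in which every term of type 𝟙 has become ().
-- Definitional equality of MCaTT only adds the η-rule for 𝟙, so definitionally
-- equal substitutions have equal normal forms and hence equal images.
-- Everything else rests on Σr (t [ γ ]) = Σr t [ Σr γ ]: a variable of type 𝟙 is
-- sent to • by Σr γ, and γ sends it to a term of type 𝟙, whose normal form is ().
-- An operation mop_{Θ,A}[γ] goes to op_{Θ,A}[•_Θ ∘ Σr γ]; this substitution is
-- well typed into Θ because the 0-cells of Θ go to terms of type 𝟙, hence to •,
-- and the suspended type of the operation is A [ •_Θ ∘ Σr γ ] because A only
-- mentions variables of the source or target of Θ, which is shown by induction
-- on CaTT derivations over sub-contexts of Θ.

module Submission where

open import Defs
open import Data.Nat using (suc; _≡ᵇ_; _<ᵇ_)
open import Data.Nat.Properties using (≡ᵇ⇒≡; ≡⇒≡ᵇ)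
open import Data.Bool using (Bool; true; false; if_then_else_)
open import Data.Bool.Properties using (T-≡)
open import Data.List using (List; []; _∷_; _++_)
open import Data.List.Membership.Propositional using (_∈_; _∉_)
open import Data.List.Membership.Propositional.Properties using (∈-++⁺ˡ; ∈-++⁺ʳ; ∈-++⁻)
open import Data.List.Relation.Unary.Any using (here; there)
open import Data.List.Relation.Binary.Subset.Propositional using (_⊆_)
open import Data.List.Relation.Binary.Subset.Propositional.Properties using (⊆-reflexive)
open import Data.Maybe using (Maybe; just; nothing)
open import Data.Product using (_×_; _,_; proj₁; proj₂; ∃-syntax)
open import Data.Sum using (_⊎_; inj₁; inj₂)
open import Data.Empty using (⊥-elim)
open import Function.Bundles using (Equivalence)
open import Relation.Binary.PropositionalEquality as ≡ using (_≡_; _≢_; refl; cong; subst)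

≡ᵇ-refl : ∀ x → (x ≡ᵇ x) ≡ true
≡ᵇ-refl x = Equivalence.to T-≡ (≡⇒≡ᵇ x x refl)

≡ᵇ-true⇒≡ : ∀ x y → (x ≡ᵇ y) ≡ true → x ≡ y
≡ᵇ-true⇒≡ x y e = ≡ᵇ⇒≡ x y (Equivalence.from T-≡ e)

≢⇒≡ᵇ-false : ∀ {x y} → x ≢ y → (x ≡ᵇ y) ≡ false
≢⇒≡ᵇ-false {x} {y} x≢y with x ≡ᵇ y in e
... | true = ⊥-elim (x≢y (≡ᵇ-true⇒≡ x y e))
... | false = refl

∈∧∉⇒≡ᵇ-false : ∀ {x y} {L : List Name} → x ∈ L → y ∉ L → (x ≡ᵇ y) ≡ false
∈∧∉⇒≡ᵇ-false {x} {y} x∈L y∉L = ≢⇒≡ᵇ-false {x} {y} λ { refl → y∉L x∈L }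

∈-tail : ∀ {x y} {L : List Name} → (x ≡ᵇ y) ≡ false → x ∈ y ∷ L → x ∈ L
∈-tail {x} e (here refl) with () ← ≡.trans (≡.sym (≡ᵇ-refl x)) e
∈-tail e (there x∈L) = x∈L

⊆-++ˡ : ∀ {L M N : List Name} → L ++ M ⊆ N → L ⊆ N
⊆-++ˡ h p = h (∈-++⁺ˡ p)

⊆-++ʳ : ∀ L {M N : List Name} → L ++ M ⊆ N → M ⊆ N
⊆-++ʳ L h p = h (∈-++⁺ʳ L p)

lookupCtx-here : ∀ Γ x A → lookupCtx (Γ , x ∶ A) x ≡ just A
lookupCtx-here Γ x A rewrite ≡ᵇ-refl x = refl

lookupCtx-there : ∀ Γ x A y → y ∈ dom Γ → x ∉ dom Γ → lookupCtx (Γ , x ∶ A) y ≡ lookupCtx Γ y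
lookupCtx-there Γ x A y y∈ x∉ rewrite ∈∧∉⇒≡ᵇ-false y∈ x∉ = refl

lookupCtx⇒∈dom : ∀ Γ x {A} → lookupCtx Γ x ≡ just A → x ∈ dom Γ
lookupCtx⇒∈dom ∅ x ()
lookupCtx⇒∈dom (Γ , y ∶ B) x eq with x ≡ᵇ y in e
... | true = here (≡ᵇ-true⇒≡ x y e)
... | false = there (lookupCtx⇒∈dom Γ x eq)

∈dom⇒lookupCtx : ∀ Γ x → x ∈ dom Γ → ∃[ A ] lookupCtx Γ x ≡ just A
∈dom⇒lookupCtx (Γ , y ∶ B) x x∈ with x ≡ᵇ y in e
... | true = B , refl
... | false = ∈dom⇒lookupCtx Γ x (∈-tail e x∈)

mlookupCtx⇒∈mdom : ∀ Γ x {A} → mlookupCtx Γ x ≡ just A → x ∈ mdom Γ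
mlookupCtx⇒∈mdom ∅ᴹ x ()
mlookupCtx⇒∈mdom (Γ ,ᴹ y ∶ B) x eq with x ≡ᵇ y in e
... | true = here (≡ᵇ-true⇒≡ x y e)
... | false = there (mlookupCtx⇒∈mdom Γ x eq)

mdom-CtxM : ∀ Θ → mdom (CtxM Θ) ≡ dom Θ
mdom-CtxM ∅ = refl
mdom-CtxM (Θ , x ∶ A) = cong (x ∷_) (mdom-CtxM Θ)

mdom-nfCtx : ∀ Γ → mdom (nfCtx Γ) ≡ mdom Γ
mdom-nfCtx ∅ᴹ = refl
mdom-nfCtx (Γ ,ᴹ x ∶ A) = cong (x ∷_) (mdom-nfCtx Γ)

mlookupCtx-CtxM : ∀ Θ x {A} → lookupCtx Θ x ≡ just A → mlookupCtx (CtxM Θ) x ≡ just (TyM A)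
mlookupCtx-CtxM ∅ x ()
mlookupCtx-CtxM (Θ , y ∶ B) x eq with x ≡ᵇ y
... | true = cong (λ { (just C) → just (TyM C) ; nothing → nothing }) eq
... | false = mlookupCtx-CtxM Θ x eq

is𝟙ᵐ : Maybe MTy → Bool
is𝟙ᵐ (just A) = is𝟙 A
is𝟙ᵐ nothing = false

is⋆ᵐ : Maybe Ty → Bool
is⋆ᵐ (just ⋆) = true
is⋆ᵐ (just (Hom _ _ _)) = false
is⋆ᵐ nothing = false

has𝟙-lookup : ∀ Γ x → has𝟙 Γ x ≡ is𝟙ᵐ (mlookupCtx Γ x)
has𝟙-lookup Γ x with mlookupCtx Γ x
... | just A = refl
... | nothing = refl

has𝟙-here : ∀ Γ x A → has𝟙 (Γ ,ᴹ x ∶ A) x ≡ is𝟙 A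
has𝟙-here Γ x A rewrite has𝟙-lookup (Γ ,ᴹ x ∶ A) x | ≡ᵇ-refl x = refl

has𝟙-there : ∀ Γ x A y → (y ≡ᵇ x) ≡ false → has𝟙 (Γ ,ᴹ x ∶ A) y ≡ has𝟙 Γ y
has𝟙-there Γ x A y e rewrite has𝟙-lookup (Γ ,ᴹ x ∶ A) y | has𝟙-lookup Γ y | e = refl

is𝟙-nfTy : ∀ Γ A → is𝟙 (nfTy Γ A) ≡ is𝟙 A
is𝟙-nfTy Γ 𝟙 = refl
is𝟙-nfTy Γ (MHom A t u) = refl

is𝟙-[]MTy : ∀ A γ → is𝟙 (A [ γ ]MTy) ≡ is𝟙 A
is𝟙-[]MTy 𝟙 γ = refl
is𝟙-[]MTy (MHom A t u) γ = refl

has𝟙-nfCtx : ∀ Γ x → has𝟙 (nfCtx Γ) x ≡ has𝟙 Γ x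
has𝟙-nfCtx Γ x rewrite has𝟙-lookup (nfCtx Γ) x | has𝟙-lookup Γ x = go Γ
  where
  go : ∀ Γ → is𝟙ᵐ (mlookupCtx (nfCtx Γ) x) ≡ is𝟙ᵐ (mlookupCtx Γ x)
  go ∅ᴹ = refl
  go (Γ ,ᴹ y ∶ A) with x ≡ᵇ y
  ... | true = is𝟙-nfTy Γ A
  ... | false = go Γ

has𝟙-CtxM : ∀ Θ x → has𝟙 (CtxM Θ) x ≡ is⋆ᵐ (lookupCtx Θ x)
has𝟙-CtxM Θ x rewrite has𝟙-lookup (CtxM Θ) x = go Θ
  where
  go : ∀ Θ → is𝟙ᵐ (mlookupCtx (CtxM Θ) x) ≡ is⋆ᵐ (lookupCtx Θ x)
  go ∅ = refl
  go (Θ , y ∶ A) with x ≡ᵇ y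
  go (Θ , y ∶ ⋆) | true = refl
  go (Θ , y ∶ Hom _ _ _) | true = refl
  ... | false = go Θ

Agree𝟙 : MCtx → MCtx → List Name → Set
Agree𝟙 D₁ D₂ L = ∀ {y} → y ∈ L → has𝟙 D₁ y ≡ has𝟙 D₂ y

Agree𝟙-fresh : ∀ D x A {L} → x ∉ L → Agree𝟙 (D ,ᴹ x ∶ A) D L
Agree𝟙-fresh D x A x∉L {y} y∈L = has𝟙-there D x A y (∈∧∉⇒≡ᵇ-false y∈L x∉L)

Agree𝟙-nfCtx : ∀ D {L} → Agree𝟙 (nfCtx D) D L
Agree𝟙-nfCtx D {y = y} _ = has𝟙-nfCtx D y

mnames : MSub → List Name
mnames ⟨⟩ᴹ = []
mnames ⟨ γ ,ᴹ x ↦ t ⟩ = x ∷ mnames γ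

names : Sub → List Name
names ⟨⟩ = []
names ⟨ γ , x ↦ t ⟩ = x ∷ names γ

mnames-nfSub : ∀ Γ D γ → mnames (nfSub Γ D γ) ≡ mnames γ
mnames-nfSub Γ D ⟨⟩ᴹ = refl
mnames-nfSub Γ D ⟨ γ ,ᴹ x ↦ t ⟩ = cong (x ∷_) (mnames-nfSub Γ D γ)

mnames-∘ᴹ : ∀ γ σ → mnames (γ ∘ᴹ σ) ≡ mnames γ
mnames-∘ᴹ ⟨⟩ᴹ σ = refl
mnames-∘ᴹ ⟨ γ ,ᴹ x ↦ t ⟩ σ = cong (x ∷_) (mnames-∘ᴹ γ σ)

mnames-SubM : ∀ σ → mnames (SubM σ) ≡ names σ
mnames-SubM ⟨⟩ = refl
mnames-SubM ⟨ σ , x ↦ t ⟩ = cong (x ∷_) (mnames-SubM σ)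

names-bulletSub : ∀ Θ → names (bulletSub Θ) ≡ dom Θ
names-bulletSub ∅ = refl
names-bulletSub (Θ , x ∶ ⋆) = cong (x ∷_) (names-bulletSub Θ)
names-bulletSub (Θ , x ∶ Hom A t u) = cong (x ∷_) (names-bulletSub Θ)

M⊢s⇒mnames : ∀ {Γ γ Δ} → Γ M⊢s γ ∶ Δ → mnames γ ≡ mdom Δ
M⊢s⇒mnames (⟨⟩ _) = refl
M⊢s⇒mnames (ext {x = x} dγ _ _) = cong (x ∷_) (M⊢s⇒mnames dγ)

⊢s⇒names : ∀ {Γ γ Δ} → Γ ⊢s γ ∶ Δ → names γ ≡ dom Δ
⊢s⇒names (⟨⟩ _) = refl
⊢s⇒names (ext {x = x} dγ _ _) = cong (x ∷_) (⊢s⇒names dγ)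

cong-ext : ∀ {γ γ' x t t'} → γ ≡ γ' → t ≡ t' → ⟨ γ , x ↦ t ⟩ ≡ ⟨ γ' , x ↦ t' ⟩
cong-ext refl refl = refl

cong-extᴹ : ∀ {γ γ' x t t'} → γ ≡ γ' → t ≡ t' → ⟨ γ ,ᴹ x ↦ t ⟩ ≡ ⟨ γ' ,ᴹ x ↦ t' ⟩
cong-extᴹ refl refl = refl

cong-Hom : ∀ {A A' t t' u u'} → A ≡ A' → t ≡ t' → u ≡ u' → Hom A t u ≡ Hom A' t' u'
cong-Hom refl refl refl = refl

cong-MHom : ∀ {A A' t t' u u'} → A ≡ A' → t ≡ t' → u ≡ u' → MHom A t u ≡ MHom A' t' u'
cong-MHom refl refl refl = refl

ΣrSub-cong-cod : ∀ D₁ D₂ γ → Agree𝟙 D₁ D₂ (mnames γ) → ΣrSub D₁ γ ≡ ΣrSub D₂ γ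
ΣrSub-cong-cod D₁ D₂ ⟨⟩ᴹ h = refl
ΣrSub-cong-cod D₁ D₂ ⟨ γ ,ᴹ x ↦ t ⟩ h
  rewrite h (here refl) | ΣrSub-cong-cod D₁ D₂ γ (λ p → h (there p)) = refl

nfSub-cong-cod : ∀ Γ D₁ D₂ γ → Agree𝟙 D₁ D₂ (mnames γ) → nfSub Γ D₁ γ ≡ nfSub Γ D₂ γ
nfSub-cong-cod Γ D₁ D₂ ⟨⟩ᴹ h = refl
nfSub-cong-cod Γ D₁ D₂ ⟨ γ ,ᴹ x ↦ t ⟩ h
  rewrite h (here refl) | nfSub-cong-cod Γ D₁ D₂ γ (λ p → h (there p)) = refl

lookupSub-ΣrSub-0 : ∀ D γ → lookupSub (ΣrSub D γ) 0 ≡ •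
lookupSub-ΣrSub-0 D ⟨⟩ᴹ = refl
lookupSub-ΣrSub-0 D ⟨ γ ,ᴹ x ↦ t ⟩ with has𝟙 D x
... | true = lookupSub-ΣrSub-0 D γ
... | false = lookupSub-ΣrSub-0 D γ

lookupSub-ΣrSub-suc : ∀ D D' Γ γ y → has𝟙 D y ≡ false → has𝟙 D' y ≡ false → y ∈ mnames γ →
                      lookupSub (ΣrSub D (nfSub Γ D' γ)) (suc y) ≡ ΣrTm (nfTm Γ (mlookupSub γ y))
lookupSub-ΣrSub-suc D D' Γ ⟨ γ ,ᴹ x ↦ t ⟩ y hD hD' y∈ with y ≡ᵇ x in e
... | true with refl ← ≡ᵇ-true⇒≡ y x e rewrite hD | hD' | ≡ᵇ-refl y = refl
... | false with has𝟙 D x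
...   | true = lookupSub-ΣrSub-suc D D' Γ γ y hD hD' (∈-tail e y∈)
...   | false rewrite e = lookupSub-ΣrSub-suc D D' Γ γ y hD hD' (∈-tail e y∈)

0∈names-ΣrSub : ∀ D γ → 0 ∈ names (ΣrSub D γ)
0∈names-ΣrSub D ⟨⟩ᴹ = here refl
0∈names-ΣrSub D ⟨ γ ,ᴹ x ↦ t ⟩ with has𝟙 D x
... | true = 0∈names-ΣrSub D γ
... | false = there (0∈names-ΣrSub D γ)

suc∈names-ΣrSub : ∀ D γ y → y ∈ mnames γ → has𝟙 D y ≡ false → suc y ∈ names (ΣrSub D γ)
suc∈names-ΣrSub D ⟨ γ ,ᴹ x ↦ t ⟩ y y∈ h with y ≡ᵇ x in e
... | true with refl ← ≡ᵇ-true⇒≡ y x e rewrite h = here refl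
... | false with has𝟙 D x
...   | true = suc∈names-ΣrSub D γ y (∈-tail e y∈) h
...   | false = there (suc∈names-ΣrSub D γ y (∈-tail e y∈) h)

-- Normal forms respect definitional equality

is𝟙-≣ty : ∀ {Γ A B} → Γ M⊢ A ≣ty B → is𝟙 A ≡ is𝟙 B
is𝟙-≣ty (refl _) = refl
is𝟙-≣ty (sym e) = ≡.sym (is𝟙-≣ty e)
is𝟙-≣ty (trans e e') = ≡.trans (is𝟙-≣ty e) (is𝟙-≣ty e')
is𝟙-≣ty (hom _ _ _) = refl

nfTm-𝟙 : ∀ {Γ t A} → Γ M⊢ t ∶ A → is𝟙 A ≡ true → nfTm Γ t ≡ ⋄
nfTm-𝟙 {Γ} (var {x = x} _ eq) h rewrite has𝟙-lookup Γ x | eq | h = refl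
nfTm-𝟙 (unit _) h = refl
nfTm-𝟙 (mop (isOp _ _ _ _ _) _) ()
nfTm-𝟙 (mcoh (isCoh _ _ _ _ _) _) ()
nfTm-𝟙 (conv dt e) h = nfTm-𝟙 dt (≡.trans (is𝟙-≣ty e) h)

nfTm-lookup-𝟙 : ∀ {Γ γ Δ} → Γ M⊢s γ ∶ Δ → ∀ y → is𝟙ᵐ (mlookupCtx Δ y) ≡ true →
                nfTm Γ (mlookupSub γ y) ≡ ⋄
nfTm-lookup-𝟙 (⟨⟩ _) y ()
nfTm-lookup-𝟙 (ext {γ = γ} {x} {A} dγ _ dt) y h with y ≡ᵇ x
... | true = nfTm-𝟙 dt (≡.trans (is𝟙-[]MTy A γ) h)
... | false = nfTm-lookup-𝟙 dγ y h

mutual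
  nfTm-≣ : ∀ {Γ t u A} → Γ M⊢ t ≣ u ∶ A → nfTm Γ t ≡ nfTm Γ u
  nfTm-≣ (refl _) = refl
  nfTm-≣ (sym e) = ≡.sym (nfTm-≣ e)
  nfTm-≣ (trans e e') = ≡.trans (nfTm-≣ e) (nfTm-≣ e')
  nfTm-≣ (conv e _) = nfTm-≣ e
  nfTm-≣ (η dt) = nfTm-𝟙 dt refl
  nfTm-≣ (mop {Θ = Θ} {A} _ e) = cong (mop Θ A) (nfSub-≣ e (CtxM Θ))
  nfTm-≣ (mcoh {Θ = Θ} {A} _ e) = cong (mcoh Θ A) (nfSub-≣ e (CtxM Θ))

  nfSub-≣ : ∀ {Γ γ γ' Δ} → Γ M⊢s γ ≣ γ' ∶ Δ → ∀ D → nfSub Γ D γ ≡ nfSub Γ D γ'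
  nfSub-≣ (⟨⟩ _) D = refl
  nfSub-≣ (ext e _ et) D rewrite nfSub-≣ e D | nfTm-≣ et = refl

nfTy-≣ty : ∀ {Γ A B} → Γ M⊢ A ≣ty B → nfTy Γ A ≡ nfTy Γ B
nfTy-≣ty (refl _) = refl
nfTy-≣ty (sym e) = ≡.sym (nfTy-≣ty e)
nfTy-≣ty (trans e e') = ≡.trans (nfTy-≣ty e) (nfTy-≣ty e')
nfTy-≣ty (hom e et eu) = cong-MHom (nfTy-≣ty e) (nfTm-≣ et) (nfTm-≣ eu)

Σr₁-resp-≣ : ∀ {Γ Δ γ γ'} → Γ M⊢s γ ≣ γ' ∶ Δ → Σr₁ Γ Δ γ ≡ Σr₁ Γ Δ γ'
Σr₁-resp-≣ {Δ = Δ} e = cong (ΣrSub (nfCtx Δ)) (nfSub-≣ e Δ)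

mutual
  M⊢ty⇒M⊢ : ∀ {Γ A} → Γ M⊢ty A → Γ M⊢
  M⊢ty⇒M⊢ (𝟙 dΓ) = dΓ
  M⊢ty⇒M⊢ (hom dt _) = M⊢tm⇒M⊢ dt

  M⊢tm⇒M⊢ : ∀ {Γ t A} → Γ M⊢ t ∶ A → Γ M⊢
  M⊢tm⇒M⊢ (var dΓ _) = dΓ
  M⊢tm⇒M⊢ (unit dΓ) = dΓ
  M⊢tm⇒M⊢ (mop _ dγ) = M⊢s⇒M⊢ dγ
  M⊢tm⇒M⊢ (mcoh _ dγ) = M⊢s⇒M⊢ dγ
  M⊢tm⇒M⊢ (conv dt _) = M⊢tm⇒M⊢ dt

  M⊢s⇒M⊢ : ∀ {Γ γ Δ} → Γ M⊢s γ ∶ Δ → Γ M⊢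
  M⊢s⇒M⊢ (⟨⟩ dΓ) = dΓ
  M⊢s⇒M⊢ (ext dγ _ _) = M⊢s⇒M⊢ dγ

M⊢s⇒M⊢cod : ∀ {Γ γ Δ} → Γ M⊢s γ ∶ Δ → Δ M⊢
M⊢s⇒M⊢cod (⟨⟩ _) = ∅ᴹ
M⊢s⇒M⊢cod (ext _ dΔ _) = dΔ

Agree𝟙-init : ∀ D {Γ x A} → x ∉ mdom Γ → Agree𝟙 D (Γ ,ᴹ x ∶ A) (x ∷ mdom Γ) → Agree𝟙 D Γ (mdom Γ)
Agree𝟙-init D {Γ} {x} {A} x∉ h p = ≡.trans (h (there p)) (Agree𝟙-fresh Γ x A x∉ p)

-- Generalised over the contexts consulted for 𝟙-variables, so that the induction goes through.
ΣrSub-nfSub-midSub : ∀ {Γ} → Γ M⊢ → ∀ D D' G →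
                     Agree𝟙 D Γ (mdom Γ) → Agree𝟙 D' Γ (mdom Γ) → Agree𝟙 G Γ (mdom Γ) →
                     ΣrSub D (nfSub G D' (midSub Γ)) ≡ idSub (Σr₀ Γ)
ΣrSub-nfSub-midSub ∅ᴹ D D' G hD hD' hG = refl
ΣrSub-nfSub-midSub (ext {Γ} {x} {𝟙} dA x∉) D D' G hD hD' hG
  rewrite hD (here refl) | has𝟙-here Γ x 𝟙 =
  ΣrSub-nfSub-midSub (M⊢ty⇒M⊢ dA) D D' G
    (Agree𝟙-init D x∉ hD) (Agree𝟙-init D' x∉ hD') (Agree𝟙-init G x∉ hG)
ΣrSub-nfSub-midSub (ext {Γ} {x} {MHom B t u} dA x∉) D D' G hD hD' hG
  rewrite hD (here refl) | hD' (here refl) | hG (here refl) | has𝟙-here Γ x (MHom B t u)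
        | ΣrSub-nfSub-midSub (M⊢ty⇒M⊢ dA) D D' G
            (Agree𝟙-init D x∉ hD) (Agree𝟙-init D' x∉ hD') (Agree𝟙-init G x∉ hG) = refl

Σr₁-midSub : ∀ {Γ} → Γ M⊢ → Σr₁ Γ Γ (midSub Γ) ≡ idSub (Σr₀ Γ)
Σr₁-midSub {Γ} dΓ = ΣrSub-nfSub-midSub dΓ (nfCtx Γ) Γ Γ (Agree𝟙-nfCtx Γ) (λ _ → refl) (λ _ → refl)

-- Associativity of substitution

lookupSub-∘ : ∀ σ τ x → x ∈ names σ → lookupSub (σ ∘ τ) x ≡ lookupSub σ x [ τ ]Tm
lookupSub-∘ ⟨ σ , y ↦ t ⟩ τ x x∈ with x ≡ᵇ y in e
... | true = refl
... | false = lookupSub-∘ σ τ x (∈-tail e x∈)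

mutual
  []Tm-∘ : ∀ t σ τ → FVTm t ⊆ names σ → t [ σ ∘ τ ]Tm ≡ t [ σ ]Tm [ τ ]Tm
  []Tm-∘ (var x) σ τ h = lookupSub-∘ σ τ x (h (here refl))
  []Tm-∘ (op Θ A γ) σ τ h = cong (op Θ A) (∘-assoc γ σ τ h)
  []Tm-∘ (coh Θ A γ) σ τ h = cong (coh Θ A) (∘-assoc γ σ τ h)

  ∘-assoc : ∀ γ σ τ → FVSub γ ⊆ names σ → γ ∘ (σ ∘ τ) ≡ (γ ∘ σ) ∘ τ
  ∘-assoc ⟨⟩ σ τ h = refl
  ∘-assoc ⟨ γ , x ↦ t ⟩ σ τ h =
    cong-ext (∘-assoc γ σ τ (⊆-++ˡ h)) ([]Tm-∘ t σ τ (⊆-++ʳ (FVSub γ) h))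

[]Ty-∘ : ∀ A σ τ → FVTy A ⊆ names σ → A [ σ ∘ τ ]Ty ≡ A [ σ ]Ty [ τ ]Ty
[]Ty-∘ ⋆ σ τ h = refl
[]Ty-∘ (Hom A t u) σ τ h =
  cong-Hom ([]Ty-∘ A σ τ (⊆-++ˡ h))
           ([]Tm-∘ t σ τ (⊆-++ˡ (⊆-++ʳ (FVTy A) h)))
           ([]Tm-∘ u σ τ (⊆-++ʳ (FVTm t) (⊆-++ʳ (FVTy A) h)))

mutual
  []Tm-drop : ∀ t σ v s → v ∉ FVTm t → t [ ⟨ σ , v ↦ s ⟩ ]Tm ≡ t [ σ ]Tm
  []Tm-drop (var w) σ v s h rewrite ≢⇒≡ᵇ-false {w} {v} (λ e → h (here (≡.sym e))) = refl
  []Tm-drop (op Θ A γ) σ v s h = cong (op Θ A) (∘-drop γ σ v s h)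
  []Tm-drop (coh Θ A γ) σ v s h = cong (coh Θ A) (∘-drop γ σ v s h)

  ∘-drop : ∀ γ σ v s → v ∉ FVSub γ → γ ∘ ⟨ σ , v ↦ s ⟩ ≡ γ ∘ σ
  ∘-drop ⟨⟩ σ v s h = refl
  ∘-drop ⟨ γ , x ↦ t ⟩ σ v s h =
    cong-ext (∘-drop γ σ v s (λ p → h (∈-++⁺ˡ p))) ([]Tm-drop t σ v s (λ p → h (∈-++⁺ʳ (FVSub γ) p)))

mutual
  TmM-[] : ∀ t σ → TmM (t [ σ ]Tm) ≡ TmM t [ SubM σ ]MTm
  TmM-[] (var x) σ = TmM-lookupSub σ x
  TmM-[] (op Θ A γ) σ = cong (mop Θ A) (SubM-∘ γ σ)
  TmM-[] (coh Θ A γ) σ = cong (mcoh Θ A) (SubM-∘ γ σ)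

  TmM-lookupSub : ∀ σ x → TmM (lookupSub σ x) ≡ mlookupSub (SubM σ) x
  TmM-lookupSub ⟨⟩ x = refl
  TmM-lookupSub ⟨ σ , y ↦ t ⟩ x with x ≡ᵇ y
  ... | true = refl
  ... | false = TmM-lookupSub σ x

  SubM-∘ : ∀ γ σ → SubM (γ ∘ σ) ≡ SubM γ ∘ᴹ SubM σ
  SubM-∘ ⟨⟩ σ = refl
  SubM-∘ ⟨ γ , x ↦ t ⟩ σ = cong-extᴹ (SubM-∘ γ σ) (TmM-[] t σ)

TyM-[] : ∀ A σ → TyM (A [ σ ]Ty) ≡ TyM A [ SubM σ ]MTy
TyM-[] ⋆ σ = refl
TyM-[] (Hom A t u) σ = cong-MHom (TyM-[] A σ) (TmM-[] t σ) (TmM-[] u σ)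

data Fresh : Ctx → Set where
  ∅   : Fresh ∅
  ext : ∀ {Θ x A} → Fresh Θ → x ∉ dom Θ → Fresh (Θ , x ∶ A)

Fresh-CtxM : ∀ Θ → CtxM Θ M⊢ → Fresh Θ
Fresh-CtxM ∅ _ = ∅
Fresh-CtxM (Θ , x ∶ A) (ext dA x∉) = ext (Fresh-CtxM Θ (M⊢ty⇒M⊢ dA)) (subst (x ∉_) (mdom-CtxM Θ) x∉)

FV-bulletSub : ∀ Θ {v} → v ∈ FVSub (bulletSub Θ) → v ≡ 0 ⊎ ∃[ x ] v ≡ suc x × x ∈ dom Θ
FV-bulletSub (Θ , x ∶ ⋆) p with ∈-++⁻ (FVSub (bulletSub Θ)) p
... | inj₂ (here refl) = inj₁ refl
... | inj₁ q with FV-bulletSub Θ q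
...   | inj₁ v≡0 = inj₁ v≡0
...   | inj₂ (y , refl , y∈) = inj₂ (y , refl , there y∈)
FV-bulletSub (Θ , x ∶ Hom A t u) p with ∈-++⁻ (FVSub (bulletSub Θ)) p
... | inj₂ (here refl) = inj₂ (x , refl , here refl)
... | inj₁ q with FV-bulletSub Θ q
...   | inj₁ v≡0 = inj₁ v≡0
...   | inj₂ (y , refl , y∈) = inj₂ (y , refl , there y∈)

FV-bulletSub-non⋆ : ∀ Θ → Fresh Θ → ∀ {x} → suc x ∈ FVSub (bulletSub Θ) → is⋆ᵐ (lookupCtx Θ x) ≡ false
FV-bulletSub-non⋆ (Θ , y ∶ ⋆) (ext fΘ y∉) {x} p with ∈-++⁻ (FVSub (bulletSub Θ)) p
... | inj₂ (here ())
... | inj₁ q with FV-bulletSub Θ q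
...   | inj₂ (_ , refl , x∈) =
  ≡.trans (cong is⋆ᵐ (lookupCtx-there Θ y ⋆ x x∈ y∉)) (FV-bulletSub-non⋆ Θ fΘ q)
FV-bulletSub-non⋆ (Θ , y ∶ Hom A t u) (ext fΘ y∉) {x} p with ∈-++⁻ (FVSub (bulletSub Θ)) p
... | inj₂ (here refl) rewrite ≡ᵇ-refl x = refl
... | inj₁ q with FV-bulletSub Θ q
...   | inj₂ (_ , refl , x∈) =
  ≡.trans (cong is⋆ᵐ (lookupCtx-there Θ y _ x x∈ y∉)) (FV-bulletSub-non⋆ Θ fΘ q)

bulletSub-∘-drop : ∀ Θ x σ s → x ∉ dom Θ → bulletSub Θ ∘ ⟨ σ , suc x ↦ s ⟩ ≡ bulletSub Θ ∘ σ
bulletSub-∘-drop Θ x σ s x∉ = ∘-drop (bulletSub Θ) σ (suc x) s suc-x∉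
  where
  suc-x∉ : suc x ∉ FVSub (bulletSub Θ)
  suc-x∉ p with FV-bulletSub Θ p
  ... | inj₂ (_ , refl , x∈) = x∉ x∈

lookupSub-bulletSub : ∀ Θ y → y ∈ dom Θ →
                      lookupSub (bulletSub Θ) y ≡ (if is⋆ᵐ (lookupCtx Θ y) then • else var (suc y))
lookupSub-bulletSub (Θ , x ∶ ⋆) y y∈ with y ≡ᵇ x in e
... | true = refl
... | false = lookupSub-bulletSub Θ y (∈-tail e y∈)
lookupSub-bulletSub (Θ , x ∶ Hom A t u) y y∈ with y ≡ᵇ x in e
... | true rewrite ≡ᵇ-true⇒≡ y x e = refl
... | false = lookupSub-bulletSub Θ y (∈-tail e y∈)

FV-bulletSub⊆names-ΣrSub : ∀ Θ γ → Fresh Θ → mnames γ ≡ dom Θ →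
                           FVSub (bulletSub Θ) ⊆ names (ΣrSub (CtxM Θ) γ)
FV-bulletSub⊆names-ΣrSub Θ γ fΘ e p with FV-bulletSub Θ p
... | inj₁ refl = 0∈names-ΣrSub (CtxM Θ) γ
... | inj₂ (x , refl , x∈) =
  suc∈names-ΣrSub (CtxM Θ) γ x (subst (x ∈_) (≡.sym e) x∈)
    (≡.trans (has𝟙-CtxM Θ x) (FV-bulletSub-non⋆ Θ fΘ p))

-- An operation additionally records the two facts about Θ and γ that the suspension of it relies on.
mutual
  data WSTm (N : List Name) : MTm → Set where
    var  : ∀ {y} → y ∈ N → WSTm N (mvar y)
    unit : WSTm N ⋄
    mop  : ∀ {Θ A γ} → Fresh Θ → mnames γ ≡ dom Θ → WSSub N γ → WSTm N (mop Θ A γ)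
    mcoh : ∀ {Θ A γ} → Fresh Θ → mnames γ ≡ dom Θ → WSSub N γ → WSTm N (mcoh Θ A γ)

  data WSSub (N : List Name) : MSub → Set where
    ⟨⟩  : WSSub N ⟨⟩ᴹ
    ext : ∀ {γ x t} → WSSub N γ → WSTm N t → WSSub N ⟨ γ ,ᴹ x ↦ t ⟩

data WSTy (N : List Name) : MTy → Set where
  𝟙   : WSTy N 𝟙
  hom : ∀ {A t u} → WSTy N A → WSTm N t → WSTm N u → WSTy N (MHom A t u)

mutual
  WSTm-mono : ∀ {N M t} → N ⊆ M → WSTm N t → WSTm M t
  WSTm-mono h (var p) = var (h p)
  WSTm-mono h unit = unit
  WSTm-mono h (mop fΘ e w) = mop fΘ e (WSSub-mono h w)
  WSTm-mono h (mcoh fΘ e w) = mcoh fΘ e (WSSub-mono h w)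

  WSSub-mono : ∀ {N M γ} → N ⊆ M → WSSub N γ → WSSub M γ
  WSSub-mono h ⟨⟩ = ⟨⟩
  WSSub-mono h (ext w wt) = ext (WSSub-mono h w) (WSTm-mono h wt)

WSTy-mono : ∀ {N M A} → N ⊆ M → WSTy N A → WSTy M A
WSTy-mono h 𝟙 = 𝟙
WSTy-mono h (hom wA wt wu) = hom (WSTy-mono h wA) (WSTm-mono h wt) (WSTm-mono h wu)

WSSub-lookup : ∀ {N γ y} → WSSub N γ → y ∈ mnames γ → WSTm N (mlookupSub γ y)
WSSub-lookup {y = y} (ext {x = x} w wt) y∈ with y ≡ᵇ x in e
... | true = wt
... | false = WSSub-lookup w (∈-tail e y∈)

WSLookup : List Name → List Name → MSub → Set
WSLookup M N γ = ∀ {y} → y ∈ M → WSTm N (mlookupSub γ y)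

mutual
  WSTm-[] : ∀ {M N t γ} → WSTm M t → WSLookup M N γ → WSTm N (t [ γ ]MTm)
  WSTm-[] (var p) h = h p
  WSTm-[] unit h = unit
  WSTm-[] {γ = γ} (mop {γ = γ₀} fΘ e w) h = mop fΘ (≡.trans (mnames-∘ᴹ γ₀ γ) e) (WSSub-∘ᴹ w h)
  WSTm-[] {γ = γ} (mcoh {γ = γ₀} fΘ e w) h = mcoh fΘ (≡.trans (mnames-∘ᴹ γ₀ γ) e) (WSSub-∘ᴹ w h)

  WSSub-∘ᴹ : ∀ {M N γ₀ γ} → WSSub M γ₀ → WSLookup M N γ → WSSub N (γ₀ ∘ᴹ γ)
  WSSub-∘ᴹ ⟨⟩ h = ⟨⟩
  WSSub-∘ᴹ (ext w wt) h = ext (WSSub-∘ᴹ w h) (WSTm-[] wt h)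

WSTy-[] : ∀ {M N A γ} → WSTy M A → WSLookup M N γ → WSTy N (A [ γ ]MTy)
WSTy-[] 𝟙 h = 𝟙
WSTy-[] (hom wA wt wu) h = hom (WSTy-[] wA h) (WSTm-[] wt h) (WSTm-[] wu h)

WSSub⇒WSLookup : ∀ {N γ M} → WSSub N γ → M ⊆ mnames γ → WSLookup M N γ
WSSub⇒WSLookup w h p = WSSub-lookup w (h p)

mutual
  WSTm-TmM⇒FV⊆ : ∀ {N} t → WSTm N (TmM t) → FVTm t ⊆ N
  WSTm-TmM⇒FV⊆ (var x) (var p) (here refl) = p
  WSTm-TmM⇒FV⊆ (op Θ A γ) (mop _ _ w) = WSSub-SubM⇒FV⊆ γ w
  WSTm-TmM⇒FV⊆ (coh Θ A γ) (mcoh _ _ w) = WSSub-SubM⇒FV⊆ γ w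

  WSSub-SubM⇒FV⊆ : ∀ {N} γ → WSSub N (SubM γ) → FVSub γ ⊆ N
  WSSub-SubM⇒FV⊆ ⟨ γ , x ↦ t ⟩ (ext w wt) p with ∈-++⁻ (FVSub γ) p
  ... | inj₁ q = WSSub-SubM⇒FV⊆ γ w q
  ... | inj₂ q = WSTm-TmM⇒FV⊆ t wt q

WSTy-TyM⇒FV⊆ : ∀ {N} A → WSTy N (TyM A) → FVTy A ⊆ N
WSTy-TyM⇒FV⊆ (Hom A t u) (hom wA wt wu) p with ∈-++⁻ (FVTy A) p
... | inj₁ q = WSTy-TyM⇒FV⊆ A wA q
... | inj₂ q with ∈-++⁻ (FVTm t) q
...   | inj₁ r = WSTm-TmM⇒FV⊆ t wt r
...   | inj₂ r = WSTm-TmM⇒FV⊆ u wu r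

mlookupSub-∘ᴹ : ∀ σ τ x → x ∈ mnames σ → mlookupSub (σ ∘ᴹ τ) x ≡ mlookupSub σ x [ τ ]MTm
mlookupSub-∘ᴹ ⟨ σ ,ᴹ y ↦ t ⟩ τ x x∈ with x ≡ᵇ y in e
... | true = refl
... | false = mlookupSub-∘ᴹ σ τ x (∈-tail e x∈)

mutual
  []MTm-∘ᴹ : ∀ {N t} → WSTm N t → ∀ σ τ → N ⊆ mnames σ → t [ σ ∘ᴹ τ ]MTm ≡ t [ σ ]MTm [ τ ]MTm
  []MTm-∘ᴹ (var {y} p) σ τ h = mlookupSub-∘ᴹ σ τ y (h p)
  []MTm-∘ᴹ unit σ τ h = refl
  []MTm-∘ᴹ (mop {Θ} {A} _ _ w) σ τ h = cong (mop Θ A) (∘ᴹ-assoc w σ τ h)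
  []MTm-∘ᴹ (mcoh {Θ} {A} _ _ w) σ τ h = cong (mcoh Θ A) (∘ᴹ-assoc w σ τ h)

  ∘ᴹ-assoc : ∀ {N γ} → WSSub N γ → ∀ σ τ → N ⊆ mnames σ → γ ∘ᴹ (σ ∘ᴹ τ) ≡ (γ ∘ᴹ σ) ∘ᴹ τ
  ∘ᴹ-assoc ⟨⟩ σ τ h = refl
  ∘ᴹ-assoc (ext w wt) σ τ h = cong-extᴹ (∘ᴹ-assoc w σ τ h) ([]MTm-∘ᴹ wt σ τ h)

[]MTy-∘ᴹ : ∀ {N A} → WSTy N A → ∀ σ τ → N ⊆ mnames σ → A [ σ ∘ᴹ τ ]MTy ≡ A [ σ ]MTy [ τ ]MTy
[]MTy-∘ᴹ 𝟙 σ τ h = refl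
[]MTy-∘ᴹ (hom wA wt wu) σ τ h = cong-MHom ([]MTy-∘ᴹ wA σ τ h) ([]MTm-∘ᴹ wt σ τ h) ([]MTm-∘ᴹ wu σ τ h)

-- Functoriality on composites

bulletΣr : MCtx → Ctx → MSub → Sub
bulletΣr Γ Θ γ = bulletSub Θ ∘ ΣrSub (CtxM Θ) (nfSub Γ (CtxM Θ) γ)

mutual
  ΣrTm-nf-[] : ∀ {Δ t} → WSTm (mdom Δ) t → ∀ {Γ γ} → Γ M⊢s γ ∶ Δ →
               ΣrTm (nfTm Γ (t [ γ ]MTm)) ≡ ΣrTm (nfTm Δ t) [ Σr₁ Γ Δ γ ]Tm
  ΣrTm-nf-[] {Δ} (var {y} y∈) {Γ} {γ} dγ with has𝟙 Δ y in h
  ... | true = ≡.trans (cong ΣrTm (nfTm-lookup-𝟙 dγ y (≡.trans (≡.sym (has𝟙-lookup Δ y)) h)))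
                       (≡.sym (lookupSub-ΣrSub-0 (nfCtx Δ) (nfSub Γ Δ γ)))
  ... | false = ≡.sym (lookupSub-ΣrSub-suc (nfCtx Δ) Δ Γ γ y (≡.trans (has𝟙-nfCtx Δ y) h) h
                         (subst (y ∈_) (≡.sym (M⊢s⇒mnames dγ)) y∈))
  ΣrTm-nf-[] {Δ} unit {Γ} {γ} dγ = ≡.sym (lookupSub-ΣrSub-0 (nfCtx Δ) (nfSub Γ Δ γ))
  ΣrTm-nf-[] (mop {Θ} {A} fΘ e w) dγ = cong (op Θ A) (bulletΣr-∘ᴹ Θ fΘ e w dγ)
  ΣrTm-nf-[] (mcoh {Θ} {A} fΘ e w) dγ = cong (coh Θ A) (bulletΣr-∘ᴹ Θ fΘ e w dγ)

  bulletΣr-∘ᴹ : ∀ Θ {Δ γ₀} → Fresh Θ → mnames γ₀ ≡ dom Θ → WSSub (mdom Δ) γ₀ →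
                ∀ {Γ γ} → Γ M⊢s γ ∶ Δ → bulletΣr Γ Θ (γ₀ ∘ᴹ γ) ≡ bulletΣr Δ Θ γ₀ ∘ Σr₁ Γ Δ γ
  bulletΣr-∘ᴹ Θ {Δ} {γ₀} fΘ e w dγ =
    ≡.trans (cong (bulletSub Θ ∘_) (ΣrSub-nf-∘ᴹ w dγ (CtxM Θ) (CtxM Θ)))
            (∘-assoc (bulletSub Θ) _ _
               (FV-bulletSub⊆names-ΣrSub Θ _ fΘ (≡.trans (mnames-nfSub Δ (CtxM Θ) γ₀) e)))

  ΣrSub-nf-∘ᴹ : ∀ {Δ γ₀} → WSSub (mdom Δ) γ₀ → ∀ {Γ γ} → Γ M⊢s γ ∶ Δ → ∀ D D' →
                ΣrSub D (nfSub Γ D' (γ₀ ∘ᴹ γ)) ≡ ΣrSub D (nfSub Δ D' γ₀) ∘ Σr₁ Γ Δ γ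
  ΣrSub-nf-∘ᴹ {Δ} ⟨⟩ {Γ} {γ} dγ D D' =
    cong-ext refl (≡.sym (lookupSub-ΣrSub-0 (nfCtx Δ) (nfSub Γ Δ γ)))
  ΣrSub-nf-∘ᴹ {Δ} (ext {x = x} w wt) {Γ} {γ} dγ D D' with has𝟙 D x
  ... | true = ΣrSub-nf-∘ᴹ w dγ D D'
  ... | false with has𝟙 D' x
  ...   | true = cong-ext (ΣrSub-nf-∘ᴹ w dγ D D') (≡.sym (lookupSub-ΣrSub-0 (nfCtx Δ) (nfSub Γ Δ γ)))
  ...   | false = cong-ext (ΣrSub-nf-∘ᴹ w dγ D D') (ΣrTm-nf-[] wt dγ)

ΣrTy-nf-[] : ∀ {Δ A} → WSTy (mdom Δ) A → ∀ {Γ γ} → Γ M⊢s γ ∶ Δ →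
             ΣrTy (nfTy Γ (A [ γ ]MTy)) ≡ ΣrTy (nfTy Δ A) [ Σr₁ Γ Δ γ ]Ty
ΣrTy-nf-[] 𝟙 dγ = refl
ΣrTy-nf-[] (hom wA wt wu) dγ = cong-Hom (ΣrTy-nf-[] wA dγ) (ΣrTm-nf-[] wt dγ) (ΣrTm-nf-[] wu dγ)

mutual
  M⊢tm⇒WSTm : ∀ {Γ t A} → Γ M⊢ t ∶ A → WSTm (mdom Γ) t
  M⊢tm⇒WSTm {Γ} (var {x = x} _ eq) = var (mlookupCtx⇒∈mdom Γ x eq)
  M⊢tm⇒WSTm (unit _) = unit
  M⊢tm⇒WSTm (mop {Θ = Θ} _ dγ) =
    mop (Fresh-CtxM Θ (M⊢s⇒M⊢cod dγ)) (≡.trans (M⊢s⇒mnames dγ) (mdom-CtxM Θ)) (M⊢s⇒WSSub dγ)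
  M⊢tm⇒WSTm (mcoh {Θ = Θ} _ dγ) =
    mcoh (Fresh-CtxM Θ (M⊢s⇒M⊢cod dγ)) (≡.trans (M⊢s⇒mnames dγ) (mdom-CtxM Θ)) (M⊢s⇒WSSub dγ)
  M⊢tm⇒WSTm (conv dt _) = M⊢tm⇒WSTm dt

  M⊢s⇒WSSub : ∀ {Γ γ Δ} → Γ M⊢s γ ∶ Δ → WSSub (mdom Γ) γ
  M⊢s⇒WSSub (⟨⟩ _) = ⟨⟩
  M⊢s⇒WSSub (ext dγ _ dt) = ext (M⊢s⇒WSSub dγ) (M⊢tm⇒WSTm dt)

Σr₁-∘ : ∀ {Γ Δ Ξ γ δ} → Γ M⊢s γ ∶ Δ → Δ M⊢s δ ∶ Ξ → Σr₁ Γ Ξ (δ ∘ᴹ γ) ≡ Σr₁ Δ Ξ δ ∘ Σr₁ Γ Δ γ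
Σr₁-∘ {Ξ = Ξ} dγ dδ = ΣrSub-nf-∘ᴹ (M⊢s⇒WSSub dδ) dγ (nfCtx Ξ) Ξ

data VarTy (N : List Name) : Ty → Set where
  ⋆   : VarTy N ⋆
  hom : ∀ {A a b} → VarTy N A → a ∈ N → b ∈ N → VarTy N (Hom A (var a) (var b))

VarTy-mono : ∀ {N M A} → N ⊆ M → VarTy N A → VarTy M A
VarTy-mono h ⋆ = ⋆
VarTy-mono h (hom vA a∈ b∈) = hom (VarTy-mono h vA) (h a∈) (h b∈)

data VarCtx : Ctx → Set where
  ∅   : VarCtx ∅
  ext : ∀ {Θ x A} → VarCtx Θ → VarTy (dom Θ) A → x ∉ dom Θ → VarCtx (Θ , x ∶ A)

VarCtx⇒Fresh : ∀ {Θ} → VarCtx Θ → Fresh Θ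
VarCtx⇒Fresh ∅ = ∅
VarCtx⇒Fresh (ext vΘ _ x∉) = ext (VarCtx⇒Fresh vΘ) x∉

VarCtx-lookup : ∀ {Θ} → VarCtx Θ → ∀ x {B} → lookupCtx Θ x ≡ just B → VarTy (dom Θ) B
VarCtx-lookup (ext {x = y} vΘ vA _) x eq with x ≡ᵇ y
VarCtx-lookup (ext vΘ vA _) x refl | true = VarTy-mono there vA
... | false = VarTy-mono there (VarCtx-lookup vΘ x eq)

∉-∷ : ∀ {f y} {L : List Name} → y ≢ f → f ∉ L → f ∉ y ∷ L
∉-∷ y≢f f∉ (here refl) = y≢f refl
∉-∷ y≢f f∉ (there p) = f∉ p

⊢ps-VarCtx : ∀ {Γ x A} → Γ ⊢ps x ∶ A → VarCtx Γ × VarTy (dom Γ) A × x ∈ dom Γ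
⊢ps-VarCtx (pss x) = ext ∅ ⋆ (λ ()) , ⋆ , here refl
⊢ps-VarCtx (pse y f d y∉ f∉ y≢f) with ⊢ps-VarCtx d
... | vΓ , vA , x∈ =
  ext (ext vΓ vA y∉) (hom (VarTy-mono there vA) (there x∈) (here refl)) (∉-∷ y≢f f∉) ,
  hom (VarTy-mono (λ p → there (there p)) vA) (there (there x∈)) (there (here refl)) ,
  here refl
⊢ps-VarCtx (psd d) with ⊢ps-VarCtx d
... | vΓ , hom vA _ y∈ , _ = vΓ , vA , y∈

ps⇒VarCtx : ∀ {Θ} → Θ ⊢ps → VarCtx Θ
ps⇒VarCtx (ps d) = proj₁ (⊢ps-VarCtx d)

data VarTyDer (Γ : Ctx) : Ty → Set where
  ⋆   : VarTyDer Γ ⋆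
  hom : ∀ {A a b} → Γ ⊢ var a ∶ A → Γ ⊢ var b ∶ A → VarTyDer Γ A → VarTyDer Γ (Hom A (var a) (var b))

VarTyDer⇒⊢ty : ∀ {Γ A} → Γ ⊢ → VarTyDer Γ A → Γ ⊢ty A
VarTyDer⇒⊢ty dΓ ⋆ = ⋆ dΓ
VarTyDer⇒⊢ty dΓ (hom da db _) = hom da db

wk-var : ∀ {Γ z A y C} → Γ ⊢ var z ∶ A → (Γ , y ∶ C) ⊢ → y ∉ dom Γ → (Γ , y ∶ C) ⊢ var z ∶ A
wk-var {Γ} {z} {y = y} {C} (var _ eq) dΓ' y∉ =
  var dΓ' (≡.trans (lookupCtx-there Γ y C z (lookupCtx⇒∈dom Γ z eq) y∉) eq)

wk-VarTyDer : ∀ {Γ A y C} → VarTyDer Γ A → (Γ , y ∶ C) ⊢ → y ∉ dom Γ → VarTyDer (Γ , y ∶ C) A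
wk-VarTyDer ⋆ dΓ' y∉ = ⋆
wk-VarTyDer (hom da db vA) dΓ' y∉ = hom (wk-var da dΓ' y∉) (wk-var db dΓ' y∉) (wk-VarTyDer vA dΓ' y∉)

⊢ps-derivable : ∀ {Γ x A} → Γ ⊢ps x ∶ A → Γ ⊢ × Γ ⊢ var x ∶ A × VarTyDer Γ A
⊢ps-derivable (pss x) = dΓ , var dΓ (lookupCtx-here ∅ x ⋆) , ⋆
  where dΓ = ext (⋆ ∅) (λ ())
⊢ps-derivable (pse {Γ} {x} {A} y f d y∉ f∉ y≢f) with ⊢ps-derivable d
... | dΓ , dx , vA =
  dΓf , var dΓf (lookupCtx-here (Γ , y ∶ A) f _) ,
  hom (wk-var dx' dΓf f∉') (wk-var dy dΓf f∉') (wk-VarTyDer (wk-VarTyDer vA dΓy y∉) dΓf f∉')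
  where
  f∉' = ∉-∷ y≢f f∉
  dΓy : (Γ , y ∶ A) ⊢
  dΓy = ext (VarTyDer⇒⊢ty dΓ vA) y∉
  dx' = wk-var dx dΓy y∉
  dy = var dΓy (lookupCtx-here Γ y A)
  dΓf = ext (hom dx' dy) f∉'
⊢ps-derivable (psd d) with ⊢ps-derivable d
... | dΓ , _ , hom _ dy vA = dΓ , dy , vA

ps⇒⊢ : ∀ {Θ} → Θ ⊢ps → Θ ⊢
ps⇒⊢ (ps d) = proj₁ (⊢ps-derivable d)

⊢s⇒⊢ : ∀ {Δ σ Ξ} → Δ ⊢s σ ∶ Ξ → Δ ⊢
⊢s⇒⊢ (⟨⟩ dΔ) = dΔ
⊢s⇒⊢ (ext dσ _ _) = ⊢s⇒⊢ dσ

⊢ty⇒⊢ : ∀ {Θ A} → Θ ⊢ty A → Θ ⊢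
⊢ty⇒⊢ (⋆ dΘ) = dΘ
⊢ty⇒⊢ (hom (var dΘ _) _) = dΘ
⊢ty⇒⊢ (hom (op _ dσ) _) = ⊢s⇒⊢ dσ
⊢ty⇒⊢ (hom (coh _ dσ) _) = ⊢s⇒⊢ dσ

-- Source and target of a ps-context are sub-contexts of it

data OPE : Ctx → Ctx → Set where
  done : OPE ∅ ∅
  keep : ∀ {Θ' Θ x A} → OPE Θ' Θ → OPE (Θ' , x ∶ A) (Θ , x ∶ A)
  drop : ∀ {Θ' Θ x A} → OPE Θ' Θ → OPE Θ' (Θ , x ∶ A)

ope-refl : ∀ Θ → OPE Θ Θ
ope-refl ∅ = done
ope-refl (Θ , x ∶ A) = keep (ope-refl Θ)

ope-trans : ∀ {Θ₁ Θ₂ Θ₃} → OPE Θ₁ Θ₂ → OPE Θ₂ Θ₃ → OPE Θ₁ Θ₃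
ope-trans p done = p
ope-trans (keep p) (keep q) = keep (ope-trans p q)
ope-trans (drop p) (keep q) = drop (ope-trans p q)
ope-trans p (drop q) = drop (ope-trans p q)

ope-dropLast : ∀ Θ → OPE (dropLast Θ) Θ
ope-dropLast ∅ = done
ope-dropLast (Θ , x ∶ A) = drop (ope-refl Θ)

ope-∂⁻ : ∀ i Θ → OPE (∂⁻_ i Θ) Θ
ope-∂⁻ i ∅ = done
ope-∂⁻ i (∅ , x ∶ A) = keep done
ope-∂⁻ i (Γ , y ∶ A , f ∶ B) with i <ᵇ suc (dimTy A)
... | true = drop (drop (ope-∂⁻ i Γ))
... | false = keep (keep (ope-∂⁻ i Γ))

ope-∂⁺ : ∀ i Θ → OPE (∂⁺_ i Θ) Θ
ope-∂⁺ i ∅ = done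
ope-∂⁺ i (∅ , x ∶ A) = keep done
ope-∂⁺ i (Γ , y ∶ A , f ∶ B) with i <ᵇ dimTy A
... | true = drop (drop (ope-∂⁺ i Γ))
... | false with dimTy A ≡ᵇ i
...   | true = drop (keep (ope-trans (ope-dropLast (∂⁺_ i Γ)) (ope-∂⁺ i Γ)))
...   | false = keep (keep (ope-∂⁺ i Γ))

ope-dom : ∀ {Θ' Θ} → OPE Θ' Θ → dom Θ' ⊆ dom Θ
ope-dom (keep p) (here e) = here e
ope-dom (keep p) (there q) = there (ope-dom p q)
ope-dom (drop p) q = there (ope-dom p q)

ope-lookup : ∀ {Θ' Θ} → OPE Θ' Θ → Fresh Θ → ∀ x {B} → lookupCtx Θ' x ≡ just B → lookupCtx Θ x ≡ just B
ope-lookup done _ x eq = eq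
ope-lookup (keep {x = y} p) (ext fΘ _) x eq with x ≡ᵇ y
... | true = eq
... | false = ope-lookup p fΘ x eq
ope-lookup {Θ'} (drop {Θ = Θ} {x = y} {A} p) (ext fΘ y∉) x eq =
  ≡.trans (lookupCtx-there Θ y A x (ope-dom p (lookupCtx⇒∈dom Θ' x eq)) y∉) (ope-lookup p fΘ x eq)

_⊑_ : Ctx → Ctx → Set
Θ' ⊑ Θ = (∀ x {B} → lookupCtx Θ' x ≡ just B → lookupCtx Θ x ≡ just B) × dom Θ' ⊆ dom Θ

ope⇒⊑ : ∀ {Θ' Θ} → OPE Θ' Θ → Fresh Θ → Θ' ⊑ Θ
ope⇒⊑ p fΘ = ope-lookup p fΘ , ope-dom p

⊑-refl : ∀ Θ → Θ ⊑ Θ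
⊑-refl Θ = (λ x eq → eq) , (λ p → p)

src⊑ : ∀ Θ → Fresh Θ → src Θ ⊑ Θ
src⊑ Θ = ope⇒⊑ (ope-∂⁻ _ Θ)

tgt⊑ : ∀ Θ → Fresh Θ → tgt Θ ⊑ Θ
tgt⊑ Θ = ope⇒⊑ (ope-∂⁺ _ Θ)

VarScoped : Ctx → List Name → Set
VarScoped Θ' N = (∀ x {B} → lookupCtx Θ' x ≡ just B → VarTy N B) × dom Θ' ⊆ N

⊑-VarScoped : ∀ {Θ Θ'} → Θ ⊢ps → Θ' ⊑ Θ → VarScoped Θ' (dom Θ)
⊑-VarScoped p (look , dom⊆) = (λ x eq → VarCtx-lookup (ps⇒VarCtx p) x (look x eq)) , dom⊆

VarTy⇒WSTy : ∀ {N B} → VarTy N B → WSTy N (TyM B)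
VarTy⇒WSTy ⋆ = 𝟙
VarTy⇒WSTy (hom vB a∈ b∈) = hom (VarTy⇒WSTy vB) (var a∈) (var b∈)

IsOp⇒ps : ∀ {Θ A} → IsOp Θ A → Θ ⊢ps
IsOp⇒ps (isOp p _ _ _ _) = p

IsCoh⇒ps : ∀ {Θ A} → IsCoh Θ A → Θ ⊢ps
IsCoh⇒ps (isCoh p _ _ _ _) = p

mnames-SubM-typed : ∀ {Θ' σ Θ} → Θ' ⊢s σ ∶ Θ → mnames (SubM σ) ≡ dom Θ
mnames-SubM-typed {σ = σ} dσ = ≡.trans (mnames-SubM σ) (⊢s⇒names dσ)

mutual
  ⊢tm⇒WS : ∀ {Θ' t B N} → Θ' ⊢ t ∶ B → VarScoped Θ' N → WSTm N (TmM t) × WSTy N (TyM B)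
  ⊢tm⇒WS {Θ'} (var {x = x} _ eq) (look , dom⊆) =
    var (dom⊆ (lookupCtx⇒∈dom Θ' x eq)) , VarTy⇒WSTy (look x eq)
  ⊢tm⇒WS (op {A = A} {σ} io dσ) sc =
    mop (VarCtx⇒Fresh (ps⇒VarCtx (IsOp⇒ps io))) (mnames-SubM-typed dσ) (⊢s⇒WSSub-SubM dσ sc) ,
    ⊢tm⇒WS-type A dσ sc (IsOp⇒WSTy io)
  ⊢tm⇒WS (coh {A = A} {σ} io dσ) sc =
    mcoh (VarCtx⇒Fresh (ps⇒VarCtx (IsCoh⇒ps io))) (mnames-SubM-typed dσ) (⊢s⇒WSSub-SubM dσ sc) ,
    ⊢tm⇒WS-type A dσ sc (IsCoh⇒WSTy io)

  ⊢tm⇒WS-type : ∀ {Θ' Θ σ N} A → Θ' ⊢s σ ∶ Θ → VarScoped Θ' N → WSTy (dom Θ) (TyM A) →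
                WSTy N (TyM (A [ σ ]Ty))
  ⊢tm⇒WS-type {σ = σ} A dσ sc wA =
    subst (WSTy _) (≡.sym (TyM-[] A σ))
      (WSTy-[] wA (WSSub⇒WSLookup (⊢s⇒WSSub-SubM dσ sc) (⊆-reflexive (≡.sym (mnames-SubM-typed dσ)))))

  ⊢s⇒WSSub-SubM : ∀ {Θ' σ Θ N} → Θ' ⊢s σ ∶ Θ → VarScoped Θ' N → WSSub N (SubM σ)
  ⊢s⇒WSSub-SubM (⟨⟩ _) sc = ⟨⟩
  ⊢s⇒WSSub-SubM (ext dσ _ dt) sc = ext (⊢s⇒WSSub-SubM dσ sc) (proj₁ (⊢tm⇒WS dt sc))

  IsOp⇒WSTy : ∀ {Θ A} → IsOp Θ A → WSTy (dom Θ) (TyM A)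
  IsOp⇒WSTy {Θ} (isOp p dt du _ _) =
    hom (proj₂ (⊢tm⇒WS dt scₛ)) (proj₁ (⊢tm⇒WS dt scₛ)) (proj₁ (⊢tm⇒WS du scₜ))
    where
    fΘ = VarCtx⇒Fresh (ps⇒VarCtx p)
    scₛ = ⊑-VarScoped p (src⊑ Θ fΘ)
    scₜ = ⊑-VarScoped p (tgt⊑ Θ fΘ)

  IsCoh⇒WSTy : ∀ {Θ A} → IsCoh Θ A → WSTy (dom Θ) (TyM A)
  IsCoh⇒WSTy {Θ} (isCoh p dt du _ _) =
    hom (proj₂ (⊢tm⇒WS dt sc)) (proj₁ (⊢tm⇒WS dt sc)) (proj₁ (⊢tm⇒WS du sc))
    where sc = ⊑-VarScoped p (⊑-refl Θ)

mutual
  ≣⇒WSTm : ∀ {Γ t u A} → Γ M⊢ t ≣ u ∶ A → WSTm (mdom Γ) t × WSTm (mdom Γ) u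
  ≣⇒WSTm (refl dt) = M⊢tm⇒WSTm dt , M⊢tm⇒WSTm dt
  ≣⇒WSTm (sym e) = proj₂ (≣⇒WSTm e) , proj₁ (≣⇒WSTm e)
  ≣⇒WSTm (trans e e') = proj₁ (≣⇒WSTm e) , proj₂ (≣⇒WSTm e')
  ≣⇒WSTm (conv e _) = ≣⇒WSTm e
  ≣⇒WSTm (η dt) = M⊢tm⇒WSTm dt , unit
  ≣⇒WSTm (mop {Θ = Θ} io e) =
    mop fΘ (≡.trans (proj₁ (≣s⇒mnames e)) (mdom-CtxM Θ)) (proj₁ (≣s⇒WSSub e)) ,
    mop fΘ (≡.trans (proj₂ (≣s⇒mnames e)) (mdom-CtxM Θ)) (proj₂ (≣s⇒WSSub e))
    where fΘ = VarCtx⇒Fresh (ps⇒VarCtx (IsOp⇒ps io))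
  ≣⇒WSTm (mcoh {Θ = Θ} io e) =
    mcoh fΘ (≡.trans (proj₁ (≣s⇒mnames e)) (mdom-CtxM Θ)) (proj₁ (≣s⇒WSSub e)) ,
    mcoh fΘ (≡.trans (proj₂ (≣s⇒mnames e)) (mdom-CtxM Θ)) (proj₂ (≣s⇒WSSub e))
    where fΘ = VarCtx⇒Fresh (ps⇒VarCtx (IsCoh⇒ps io))

  ≣s⇒WSSub : ∀ {Γ γ γ' Δ} → Γ M⊢s γ ≣ γ' ∶ Δ → WSSub (mdom Γ) γ × WSSub (mdom Γ) γ'
  ≣s⇒WSSub (⟨⟩ _) = ⟨⟩ , ⟨⟩
  ≣s⇒WSSub (ext e _ et) =
    ext (proj₁ (≣s⇒WSSub e)) (proj₁ (≣⇒WSTm et)) , ext (proj₂ (≣s⇒WSSub e)) (proj₂ (≣⇒WSTm et))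

  ≣s⇒mnames : ∀ {Γ γ γ' Δ} → Γ M⊢s γ ≣ γ' ∶ Δ → mnames γ ≡ mdom Δ × mnames γ' ≡ mdom Δ
  ≣s⇒mnames (⟨⟩ _) = refl , refl
  ≣s⇒mnames (ext {x = x} e _ _) = cong (x ∷_) (proj₁ (≣s⇒mnames e)) , cong (x ∷_) (proj₂ (≣s⇒mnames e))

M⊢-op-type⇒WSTy : ∀ {Γ γ Θ} A → Γ M⊢s γ ∶ CtxM Θ → WSTy (dom Θ) (TyM A) → WSTy (mdom Γ) (TyM A [ γ ]MTy)
M⊢-op-type⇒WSTy {Θ = Θ} A dγ wA =
  WSTy-[] (subst (λ N → WSTy N (TyM A)) (≡.sym (mdom-CtxM Θ)) wA)
          (WSSub⇒WSLookup (M⊢s⇒WSSub dγ) (⊆-reflexive (≡.sym (M⊢s⇒mnames dγ))))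

mutual
  M⊢ty⇒WSTy : ∀ {Γ A} → Γ M⊢ty A → WSTy (mdom Γ) A
  M⊢ty⇒WSTy (𝟙 _) = 𝟙
  M⊢ty⇒WSTy (hom dt du) = hom (M⊢tm⇒WSTy dt) (M⊢tm⇒WSTm dt) (M⊢tm⇒WSTm du)

  M⊢tm⇒WSTy : ∀ {Γ t A} → Γ M⊢ t ∶ A → WSTy (mdom Γ) A
  M⊢tm⇒WSTy (var dΓ eq) = M⊢-lookup⇒WSTy dΓ _ eq
  M⊢tm⇒WSTy (unit _) = 𝟙
  M⊢tm⇒WSTy (mop {A = A} io dγ) = M⊢-op-type⇒WSTy A dγ (IsOp⇒WSTy io)
  M⊢tm⇒WSTy (mcoh {A = A} io dγ) = M⊢-op-type⇒WSTy A dγ (IsCoh⇒WSTy io)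
  M⊢tm⇒WSTy (conv _ e) = proj₂ (≣ty⇒WSTy e)

  M⊢-lookup⇒WSTy : ∀ {Γ} → Γ M⊢ → ∀ x {A} → mlookupCtx Γ x ≡ just A → WSTy (mdom Γ) A
  M⊢-lookup⇒WSTy (ext {x = y} dA y∉) x eq with x ≡ᵇ y
  M⊢-lookup⇒WSTy (ext dA y∉) x refl | true = WSTy-mono there (M⊢ty⇒WSTy dA)
  ... | false = WSTy-mono there (M⊢-lookup⇒WSTy (M⊢ty⇒M⊢ dA) x eq)

  ≣ty⇒WSTy : ∀ {Γ A B} → Γ M⊢ A ≣ty B → WSTy (mdom Γ) A × WSTy (mdom Γ) B
  ≣ty⇒WSTy (refl dA) = M⊢ty⇒WSTy dA , M⊢ty⇒WSTy dA
  ≣ty⇒WSTy (sym e) = proj₂ (≣ty⇒WSTy e) , proj₁ (≣ty⇒WSTy e)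
  ≣ty⇒WSTy (trans e e') = proj₁ (≣ty⇒WSTy e) , proj₂ (≣ty⇒WSTy e')
  ≣ty⇒WSTy (hom e et eu) =
    hom (proj₁ (≣ty⇒WSTy e)) (proj₁ (≣⇒WSTm et)) (proj₁ (≣⇒WSTm eu)) ,
    hom (proj₂ (≣ty⇒WSTy e)) (proj₂ (≣⇒WSTm et)) (proj₂ (≣⇒WSTm eu))

-- Suspending CaTT expressions read in MCaTT

⊢s-lookup-⋆ : ∀ {Θ' σ Θ} → Θ' ⊢s σ ∶ Θ → ∀ x → lookupCtx Θ x ≡ just ⋆ → Θ' ⊢ lookupSub σ x ∶ ⋆
⊢s-lookup-⋆ (ext {x = y} dσ _ dt) x eq with x ≡ᵇ y
⊢s-lookup-⋆ (ext dσ _ dt) x refl | true = dt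
... | false = ⊢s-lookup-⋆ dσ x eq

⊢⋆-inversion : ∀ {Θ' t B} → Θ' ⊢ t ∶ B → B ≡ ⋆ → ∃[ y ] t ≡ var y × lookupCtx Θ' y ≡ just ⋆
⊢⋆-inversion (var {x = x} _ eq) refl = x , refl , eq
⊢⋆-inversion (op (isOp _ _ _ _ _) _) ()
⊢⋆-inversion (coh (isCoh _ _ _ _ _) _) ()

module SuspendCaTT (Γ : MCtx) where

  Fits : Ctx → MSub → Set
  Fits Θ γ = (∀ x → lookupCtx Θ x ≡ just ⋆ → nfTm Γ (mlookupSub γ x) ≡ ⋄) × dom Θ ⊆ mnames γ

  ΣrTm-lookup : ∀ Θ γ → Fits Θ γ → ∀ y → y ∈ dom Θ →
                ΣrTm (nfTm Γ (mlookupSub γ y)) ≡ lookupSub (bulletΣr Γ Θ γ) y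
  ΣrTm-lookup Θ γ (sends⋆ , covers) y y∈
    rewrite lookupSub-∘ (bulletSub Θ) (ΣrSub (CtxM Θ) (nfSub Γ (CtxM Θ) γ)) y
              (subst (y ∈_) (≡.sym (names-bulletSub Θ)) y∈)
          | lookupSub-bulletSub Θ y y∈
    with lookupCtx Θ y in h
  ... | just ⋆ = ≡.trans (cong ΣrTm (sends⋆ y h)) (≡.sym (lookupSub-ΣrSub-0 (CtxM Θ) (nfSub Γ (CtxM Θ) γ)))
  ... | just (Hom _ _ _) = ≡.sym (lookupSub-ΣrSub-suc (CtxM Θ) (CtxM Θ) Γ γ y non𝟙 non𝟙 (covers y∈))
    where non𝟙 = ≡.trans (has𝟙-CtxM Θ y) (cong is⋆ᵐ h)
  ... | nothing with ∈dom⇒lookupCtx Θ y y∈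
  ...   | _ , h' with () ← ≡.trans (≡.sym h) h'

  ΣrTy-VarTy : ∀ Θ γ → Fits Θ γ → ∀ {B} → VarTy (dom Θ) B →
               ΣrTy (nfTy Γ (TyM B [ γ ]MTy)) ≡ B [ bulletΣr Γ Θ γ ]Ty
  ΣrTy-VarTy Θ γ fits ⋆ = refl
  ΣrTy-VarTy Θ γ fits (hom vB a∈ b∈) =
    cong-Hom (ΣrTy-VarTy Θ γ fits vB) (ΣrTm-lookup Θ γ fits _ a∈) (ΣrTm-lookup Θ γ fits _ b∈)

  Fits-∘ᴹ : ∀ {Θ' σ Θ₂} → Θ' ⊢s σ ∶ Θ₂ → ∀ Θ → Θ' ⊑ Θ → ∀ γ → Fits Θ γ → Fits Θ₂ (SubM σ ∘ᴹ γ)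
  Fits-∘ᴹ {σ = σ} {Θ₂} dσ Θ (look , _) γ (sends⋆ , covers) = sends⋆' , covers'
    where
    sends⋆' : ∀ x → lookupCtx Θ₂ x ≡ just ⋆ → nfTm Γ (mlookupSub (SubM σ ∘ᴹ γ) x) ≡ ⋄
    sends⋆' x eq with ⊢⋆-inversion (⊢s-lookup-⋆ dσ x eq) refl
    ... | y , e , y⋆
      rewrite mlookupSub-∘ᴹ (SubM σ) γ x
                (subst (x ∈_) (≡.sym (mnames-SubM-typed dσ)) (lookupCtx⇒∈dom Θ₂ x eq))
            | ≡.sym (TmM-lookupSub σ x) | e = sends⋆ y (look y y⋆)
    covers' : dom Θ₂ ⊆ mnames (SubM σ ∘ᴹ γ)
    covers' = ⊆-reflexive (≡.sym (≡.trans (mnames-∘ᴹ (SubM σ) γ) (mnames-SubM-typed dσ)))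

  mutual
    ΣrTm-TmM : ∀ {Θ' t B} → Θ' ⊢ t ∶ B → ∀ Θ → VarCtx Θ → Θ' ⊑ Θ → ∀ γ → Fits Θ γ →
               ΣrTm (nfTm Γ (TmM t [ γ ]MTm)) ≡ t [ bulletΣr Γ Θ γ ]Tm
             × ΣrTy (nfTy Γ (TyM B [ γ ]MTy)) ≡ B [ bulletΣr Γ Θ γ ]Ty
    ΣrTm-TmM {Θ'} (var {x = x} _ eq) Θ vΘ (look , dom⊆) γ fits =
      ΣrTm-lookup Θ γ fits x (dom⊆ (lookupCtx⇒∈dom Θ' x eq)) ,
      ΣrTy-VarTy Θ γ fits (VarCtx-lookup vΘ x (look x eq))
    ΣrTm-TmM (op {Θ = Θ₂} {A₂} {σ} io dσ) Θ vΘ Θ'⊑Θ γ fits =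
      cong (op Θ₂ A₂) (bulletΣr-SubM dσ Θ vΘ Θ'⊑Θ γ fits (CtxM Θ₂) (λ _ → refl)) ,
      ΣrTy-TyM-[] A₂ (IsOp⇒WSTy io) dσ Θ vΘ Θ'⊑Θ γ fits
        (ΣrTy-IsOp io (SubM σ ∘ᴹ γ) (Fits-∘ᴹ dσ Θ Θ'⊑Θ γ fits))
    ΣrTm-TmM (coh {Θ = Θ₂} {A₂} {σ} io dσ) Θ vΘ Θ'⊑Θ γ fits =
      cong (coh Θ₂ A₂) (bulletΣr-SubM dσ Θ vΘ Θ'⊑Θ γ fits (CtxM Θ₂) (λ _ → refl)) ,
      ΣrTy-TyM-[] A₂ (IsCoh⇒WSTy io) dσ Θ vΘ Θ'⊑Θ γ fits
        (ΣrTy-IsCoh io (SubM σ ∘ᴹ γ) (Fits-∘ᴹ dσ Θ Θ'⊑Θ γ fits))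

    bulletΣr-SubM : ∀ {Θ' σ Θ₂} → Θ' ⊢s σ ∶ Θ₂ → ∀ Θ → VarCtx Θ → Θ' ⊑ Θ → ∀ γ → Fits Θ γ →
                    ∀ D → Agree𝟙 D (CtxM Θ₂) (dom Θ₂) →
                    bulletSub Θ₂ ∘ ΣrSub D (nfSub Γ D (SubM σ ∘ᴹ γ)) ≡ σ ∘ bulletΣr Γ Θ γ
    bulletΣr-SubM (⟨⟩ _) Θ vΘ Θ'⊑Θ γ fits D ag = refl
    bulletΣr-SubM (ext {Δ = Θ₂} {σ} {x} {⋆} dσ (ext _ x∉) dt) Θ vΘ Θ'⊑Θ γ fits D ag
      rewrite ≡.trans (ag (here refl)) (has𝟙-here (CtxM Θ₂) x 𝟙)
      with ⊢⋆-inversion dt refl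
    ... | y , refl , y⋆ =
      cong-ext
        (bulletΣr-SubM dσ Θ vΘ Θ'⊑Θ γ fits D (λ p → ≡.trans (ag (there p)) (Agree𝟙-fresh (CtxM Θ₂) x 𝟙 x∉ p)))
        (≡.trans (lookupSub-ΣrSub-0 D (nfSub Γ D (SubM σ ∘ᴹ γ)))
           (≡.trans (cong ΣrTm (≡.sym (proj₁ fits y (proj₁ Θ'⊑Θ y y⋆))))
              (proj₁ (ΣrTm-TmM dt Θ vΘ Θ'⊑Θ γ fits))))
    bulletΣr-SubM (ext {Δ = Θ₂} {σ} {x} {Hom A a b} dσ (ext _ x∉) dt) Θ vΘ Θ'⊑Θ γ fits D ag
      rewrite ≡.trans (ag (here refl)) (has𝟙-here (CtxM Θ₂) x (TyM (Hom A a b))) | ≡ᵇ-refl x =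
      cong-ext
        (≡.trans (bulletSub-∘-drop Θ₂ x _ _ x∉)
          (bulletΣr-SubM dσ Θ vΘ Θ'⊑Θ γ fits D
            (λ p → ≡.trans (ag (there p)) (Agree𝟙-fresh (CtxM Θ₂) x (TyM (Hom A a b)) x∉ p))))
        (proj₁ (ΣrTm-TmM dt Θ vΘ Θ'⊑Θ γ fits))

    ΣrTy-IsOp : ∀ {Θ A} → IsOp Θ A → ∀ γ → Fits Θ γ → ΣrTy (nfTy Γ (TyM A [ γ ]MTy)) ≡ A [ bulletΣr Γ Θ γ ]Ty
    ΣrTy-IsOp {Θ} (isOp p dt du _ _) γ fits =
      cong-Hom (proj₂ (ΣrTm-TmM dt Θ vΘ (src⊑ Θ fΘ) γ fits))
               (proj₁ (ΣrTm-TmM dt Θ vΘ (src⊑ Θ fΘ) γ fits))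
               (proj₁ (ΣrTm-TmM du Θ vΘ (tgt⊑ Θ fΘ) γ fits))
      where
      vΘ = ps⇒VarCtx p
      fΘ = VarCtx⇒Fresh vΘ

    ΣrTy-IsCoh : ∀ {Θ A} → IsCoh Θ A → ∀ γ → Fits Θ γ → ΣrTy (nfTy Γ (TyM A [ γ ]MTy)) ≡ A [ bulletΣr Γ Θ γ ]Ty
    ΣrTy-IsCoh {Θ} (isCoh p dt du _ _) γ fits =
      cong-Hom (proj₂ (ΣrTm-TmM dt Θ vΘ (⊑-refl Θ) γ fits))
               (proj₁ (ΣrTm-TmM dt Θ vΘ (⊑-refl Θ) γ fits))
               (proj₁ (ΣrTm-TmM du Θ vΘ (⊑-refl Θ) γ fits))
      where vΘ = ps⇒VarCtx p

    ΣrTy-TyM-[] : ∀ {Θ' Θ₂} A₂ {σ} → WSTy (dom Θ₂) (TyM A₂) → Θ' ⊢s σ ∶ Θ₂ →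
                  ∀ Θ → VarCtx Θ → Θ' ⊑ Θ → ∀ γ → Fits Θ γ →
                  ΣrTy (nfTy Γ (TyM A₂ [ SubM σ ∘ᴹ γ ]MTy)) ≡ A₂ [ bulletΣr Γ Θ₂ (SubM σ ∘ᴹ γ) ]Ty →
                  ΣrTy (nfTy Γ (TyM (A₂ [ σ ]Ty) [ γ ]MTy)) ≡ A₂ [ σ ]Ty [ bulletΣr Γ Θ γ ]Ty
    ΣrTy-TyM-[] {Θ₂ = Θ₂} A₂ {σ} wA dσ Θ vΘ Θ'⊑Θ γ fits ih =
      begin
        ΣrTy (nfTy Γ (TyM (A₂ [ σ ]Ty) [ γ ]MTy))
      ≡⟨ cong (λ T → ΣrTy (nfTy Γ (T [ γ ]MTy))) (TyM-[] A₂ σ) ⟩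
        ΣrTy (nfTy Γ (TyM A₂ [ SubM σ ]MTy [ γ ]MTy))
      ≡⟨ cong (λ T → ΣrTy (nfTy Γ T)) (≡.sym ([]MTy-∘ᴹ wA (SubM σ) γ A₂⊆σ)) ⟩
        ΣrTy (nfTy Γ (TyM A₂ [ SubM σ ∘ᴹ γ ]MTy))
      ≡⟨ ih ⟩
        A₂ [ bulletΣr Γ Θ₂ (SubM σ ∘ᴹ γ) ]Ty
      ≡⟨ cong (A₂ [_]Ty) (bulletΣr-SubM dσ Θ vΘ Θ'⊑Θ γ fits (CtxM Θ₂) (λ _ → refl)) ⟩
        A₂ [ σ ∘ bulletΣr Γ Θ γ ]Ty
      ≡⟨ []Ty-∘ A₂ σ (bulletΣr Γ Θ γ) (λ p → subst (_ ∈_) (≡.sym (⊢s⇒names dσ)) (WSTy-TyM⇒FV⊆ A₂ wA p)) ⟩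
        A₂ [ σ ]Ty [ bulletΣr Γ Θ γ ]Ty
      ∎
      where
      open ≡.≡-Reasoning
      A₂⊆σ : dom Θ₂ ⊆ mnames (SubM σ)
      A₂⊆σ = ⊆-reflexive (≡.sym (mnames-SubM-typed dσ))

-- Σr preserves derivability

mutual
  nfTm-cong-ctx : ∀ {N t} → WSTm N t → ∀ G G' → Agree𝟙 G G' N → nfTm G t ≡ nfTm G' t
  nfTm-cong-ctx (var p) G G' h rewrite h p = refl
  nfTm-cong-ctx unit G G' h = refl
  nfTm-cong-ctx (mop {Θ} {A} _ _ w) G G' h = cong (mop Θ A) (nfSub-cong-ctx w G G' h _)
  nfTm-cong-ctx (mcoh {Θ} {A} _ _ w) G G' h = cong (mcoh Θ A) (nfSub-cong-ctx w G G' h _)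

  nfSub-cong-ctx : ∀ {N γ} → WSSub N γ → ∀ G G' → Agree𝟙 G G' N → ∀ D → nfSub G D γ ≡ nfSub G' D γ
  nfSub-cong-ctx ⟨⟩ G G' h D = refl
  nfSub-cong-ctx (ext w wt) G G' h D rewrite nfSub-cong-ctx w G G' h D | nfTm-cong-ctx wt G G' h = refl

nfTy-cong-ctx : ∀ {N A} → WSTy N A → ∀ G G' → Agree𝟙 G G' N → nfTy G A ≡ nfTy G' A
nfTy-cong-ctx 𝟙 G G' h = refl
nfTy-cong-ctx (hom wA wt wu) G G' h =
  cong-MHom (nfTy-cong-ctx wA G G' h) (nfTm-cong-ctx wt G G' h) (nfTm-cong-ctx wu G G' h)

lookupCtx-ΣrCtx-0 : ∀ D → lookupCtx (ΣrCtx D) 0 ≡ just ⋆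
lookupCtx-ΣrCtx-0 ∅ᴹ = refl
lookupCtx-ΣrCtx-0 (D ,ᴹ x ∶ 𝟙) = lookupCtx-ΣrCtx-0 D
lookupCtx-ΣrCtx-0 (D ,ᴹ x ∶ MHom A t u) = lookupCtx-ΣrCtx-0 D

suc∈dom-ΣrCtx⇒∈mdom : ∀ D x → suc x ∈ dom (ΣrCtx D) → x ∈ mdom D
suc∈dom-ΣrCtx⇒∈mdom ∅ᴹ x (here ())
suc∈dom-ΣrCtx⇒∈mdom (D ,ᴹ y ∶ 𝟙) x p = there (suc∈dom-ΣrCtx⇒∈mdom D x p)
suc∈dom-ΣrCtx⇒∈mdom (D ,ᴹ y ∶ MHom A t u) x (here refl) = here refl
suc∈dom-ΣrCtx⇒∈mdom (D ,ᴹ y ∶ MHom A t u) x (there p) = there (suc∈dom-ΣrCtx⇒∈mdom D x p)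

suc∉dom-Σr₀ : ∀ Γ x → x ∉ mdom Γ → suc x ∉ dom (Σr₀ Γ)
suc∉dom-Σr₀ Γ x x∉ p = x∉ (subst (x ∈_) (mdom-nfCtx Γ) (suc∈dom-ΣrCtx⇒∈mdom (nfCtx Γ) x p))

lookupCtx-Σr₀-suc : ∀ {Γ} → Γ M⊢ → ∀ x {A} → mlookupCtx Γ x ≡ just A → is𝟙 A ≡ false →
                    lookupCtx (Σr₀ Γ) (suc x) ≡ just (ΣrTy (nfTy Γ A))
lookupCtx-Σr₀-suc (ext {Γ} {y} {B} dB y∉) x {A} eq non𝟙 with x ≡ᵇ y in e
lookupCtx-Σr₀-suc (ext {Γ} {y} {𝟙} dB y∉) x refl () | true
lookupCtx-Σr₀-suc (ext {Γ} {y} {MHom B t u} dB y∉) x refl non𝟙 | true rewrite e =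
  cong (λ T → just (ΣrTy T))
    (≡.sym (nfTy-cong-ctx (M⊢ty⇒WSTy dB) (Γ ,ᴹ y ∶ MHom B t u) Γ (Agree𝟙-fresh Γ y _ y∉)))
lookupCtx-Σr₀-suc (ext {Γ} {y} {B} dB y∉) x {A} eq non𝟙 | false
  rewrite nfTy-cong-ctx (M⊢-lookup⇒WSTy (M⊢ty⇒M⊢ dB) x eq) (Γ ,ᴹ y ∶ B) Γ (Agree𝟙-fresh Γ y _ y∉) = go B
  where
  go : ∀ B → lookupCtx (ΣrCtx (nfCtx Γ ,ᴹ y ∶ nfTy Γ B)) (suc x) ≡ just (ΣrTy (nfTy Γ A))
  go 𝟙 = lookupCtx-Σr₀-suc (M⊢ty⇒M⊢ dB) x eq non𝟙
  go (MHom _ _ _) rewrite e = lookupCtx-Σr₀-suc (M⊢ty⇒M⊢ dB) x eq non𝟙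

ΣrTm-nf-CtxM-var : ∀ Θ a → a ∈ dom Θ → ΣrTm (nfTm (CtxM Θ) (mvar a)) ≡ lookupSub (bulletSub Θ) a
ΣrTm-nf-CtxM-var Θ a a∈ rewrite lookupSub-bulletSub Θ a a∈ | has𝟙-CtxM Θ a with is⋆ᵐ (lookupCtx Θ a)
... | true = refl
... | false = refl

ΣrTy-nf-TyM : ∀ Θ {B} → VarTy (dom Θ) B → ∀ τ →
              ΣrTy (nfTy (CtxM Θ) (TyM B)) [ τ ]Ty ≡ B [ bulletSub Θ ∘ τ ]Ty
ΣrTy-nf-TyM Θ ⋆ τ = refl
ΣrTy-nf-TyM Θ (hom vB a∈ b∈) τ = cong-Hom (ΣrTy-nf-TyM Θ vB τ) (var-case _ a∈) (var-case _ b∈)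
  where
  var-case : ∀ a → a ∈ dom Θ → ΣrTm (nfTm (CtxM Θ) (mvar a)) [ τ ]Tm ≡ lookupSub (bulletSub Θ ∘ τ) a
  var-case a a∈ rewrite ΣrTm-nf-CtxM-var Θ a a∈ =
    ≡.sym (lookupSub-∘ (bulletSub Θ) τ a (subst (a ∈_) (≡.sym (names-bulletSub Θ)) a∈))

bulletSub-∘-⊢s : ∀ {Θ} → Θ ⊢ → VarCtx Θ → ∀ {Δ σ} → Δ ⊢s σ ∶ Σr₀ (CtxM Θ) → Δ ⊢s bulletSub Θ ∘ σ ∶ Θ
bulletSub-∘-⊢s ∅ ∅ dσ = ⟨⟩ (⊢s⇒⊢ dσ)
bulletSub-∘-⊢s (ext {Θ} {x} {⋆} dA x∉) (ext vΘ _ _) dσ =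
  ext (bulletSub-∘-⊢s (⊢ty⇒⊢ dA) vΘ dσ) (ext dA x∉) (⊢s-lookup-⋆ dσ 0 (lookupCtx-ΣrCtx-0 (nfCtx (CtxM Θ))))
bulletSub-∘-⊢s (ext {Θ} {x} {Hom A a b} dA x∉) (ext vΘ vA _) {Δ} (ext {γ = σ} {t = s} dσ _ ds)
  rewrite ≡ᵇ-refl x | bulletSub-∘-drop Θ x σ s x∉ =
  ext (bulletSub-∘-⊢s (⊢ty⇒⊢ dA) vΘ dσ) (ext dA x∉) (subst (Δ ⊢ s ∶_) (ΣrTy-nf-TyM Θ vA σ) ds)

M⊢s⇒Fits : ∀ {Γ γ Θ} → Γ M⊢s γ ∶ CtxM Θ → SuspendCaTT.Fits Γ Θ γ
M⊢s⇒Fits {Θ = Θ} dγ =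
  (λ x eq → nfTm-lookup-𝟙 dγ x (cong is𝟙ᵐ (mlookupCtx-CtxM Θ x eq))) ,
  ⊆-reflexive (≡.sym (≡.trans (M⊢s⇒mnames dγ) (mdom-CtxM Θ)))

Σr₁-fresh-cod : ∀ Γ Δ γ x A → Γ M⊢s γ ∶ Δ → x ∉ mdom Δ →
                ΣrSub (nfCtx Δ ,ᴹ x ∶ nfTy Δ A) (nfSub Γ (Δ ,ᴹ x ∶ A) γ) ≡ Σr₁ Γ Δ γ
Σr₁-fresh-cod Γ Δ γ x A dγ x∉ =
  ≡.trans (cong (ΣrSub (nfCtx Δ ,ᴹ x ∶ nfTy Δ A)) (nfSub-cong-cod Γ (Δ ,ᴹ x ∶ A) Δ γ (Agree𝟙-fresh Δ x A x∉γ)))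
          (ΣrSub-cong-cod _ (nfCtx Δ) (nfSub Γ Δ γ) (Agree𝟙-fresh (nfCtx Δ) x _ x∉nfγ))
  where
  x∉γ : x ∉ mnames γ
  x∉γ p = x∉ (subst (x ∈_) (M⊢s⇒mnames dγ) p)
  x∉nfγ : x ∉ mnames (nfSub Γ Δ γ)
  x∉nfγ p = x∉γ (subst (x ∈_) (mnames-nfSub Γ Δ γ) p)

Σr₁-ext-𝟙-⊢s : ∀ Γ Δ γ x t → Γ M⊢s γ ∶ Δ → x ∉ mdom Δ → Σr₀ Γ ⊢s Σr₁ Γ Δ γ ∶ Σr₀ Δ →
               Σr₀ Γ ⊢s Σr₁ Γ (Δ ,ᴹ x ∶ 𝟙) ⟨ γ ,ᴹ x ↦ t ⟩ ∶ Σr₀ (Δ ,ᴹ x ∶ 𝟙)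
Σr₁-ext-𝟙-⊢s Γ Δ γ x t dγ x∉ ih rewrite has𝟙-here (nfCtx Δ) x 𝟙 =
  subst (λ s → Σr₀ Γ ⊢s s ∶ Σr₀ Δ) (≡.sym (Σr₁-fresh-cod Γ Δ γ x 𝟙 dγ x∉)) ih

Σr₁-ext-hom-⊢s : ∀ Γ Δ γ x B u v t → Γ M⊢s γ ∶ Δ → Δ M⊢ty MHom B u v → x ∉ mdom Δ →
                 Σr₀ Γ ⊢s Σr₁ Γ Δ γ ∶ Σr₀ Δ → Σr₀ (Δ ,ᴹ x ∶ MHom B u v) ⊢ →
                 Σr₀ Γ ⊢ ΣrTm (nfTm Γ t) ∶ ΣrTy (nfTy Γ (MHom B u v [ γ ]MTy)) →
                 Σr₀ Γ ⊢s Σr₁ Γ (Δ ,ᴹ x ∶ MHom B u v) ⟨ γ ,ᴹ x ↦ t ⟩ ∶ Σr₀ (Δ ,ᴹ x ∶ MHom B u v)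
Σr₁-ext-hom-⊢s Γ Δ γ x B u v t dγ dA x∉ ih dΔ' dt
  rewrite has𝟙-here (nfCtx Δ) x (MHom (nfTy Δ B) (nfTm Δ u) (nfTm Δ v)) | has𝟙-here Δ x (MHom B u v) =
  subst (λ s → Σr₀ Γ ⊢s ⟨ s , suc x ↦ ΣrTm (nfTm Γ t) ⟩ ∶ Σr₀ (Δ ,ᴹ x ∶ MHom B u v))
    (≡.sym (Σr₁-fresh-cod Γ Δ γ x (MHom B u v) dγ x∉))
    (ext ih dΔ' (subst (Σr₀ Γ ⊢ ΣrTm (nfTm Γ t) ∶_) (ΣrTy-nf-[] (M⊢ty⇒WSTy dA) dγ) dt))

mutual
  Σr₀-⊢ : ∀ {Γ} → Γ M⊢ → Σr₀ Γ ⊢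
  Σr₀-⊢ ∅ᴹ = ext (⋆ ∅) (λ ())
  Σr₀-⊢ (ext (𝟙 dΓ) x∉) = Σr₀-⊢ dΓ
  Σr₀-⊢ (ext {Γ} {x} dA@(hom _ _) x∉) = ext (ΣrTy-⊢ dA) (suc∉dom-Σr₀ Γ x x∉)

  ΣrTy-⊢ : ∀ {Γ A} → Γ M⊢ty A → Σr₀ Γ ⊢ty ΣrTy (nfTy Γ A)
  ΣrTy-⊢ (𝟙 dΓ) = ⋆ (Σr₀-⊢ dΓ)
  ΣrTy-⊢ (hom dt du) = hom (ΣrTm-⊢ dt) (ΣrTm-⊢ du)

  ΣrTm-⊢ : ∀ {Γ t A} → Γ M⊢ t ∶ A → Σr₀ Γ ⊢ ΣrTm (nfTm Γ t) ∶ ΣrTy (nfTy Γ A)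
  ΣrTm-⊢ (var {x = x} {A} dΓ eq) = ΣrTm-var-⊢ dΓ x A eq
  ΣrTm-⊢ {Γ} (unit dΓ) = var (Σr₀-⊢ dΓ) (lookupCtx-ΣrCtx-0 (nfCtx Γ))
  ΣrTm-⊢ {Γ} (mop {Θ = Θ} {A} {γ} io dγ) =
    subst (Σr₀ Γ ⊢ op Θ A (bulletΣr Γ Θ γ) ∶_) (≡.sym (SuspendCaTT.ΣrTy-IsOp Γ io γ (M⊢s⇒Fits dγ)))
      (op io (bulletΣr-⊢s (IsOp⇒ps io) dγ))
  ΣrTm-⊢ {Γ} (mcoh {Θ = Θ} {A} {γ} io dγ) =
    subst (Σr₀ Γ ⊢ coh Θ A (bulletΣr Γ Θ γ) ∶_) (≡.sym (SuspendCaTT.ΣrTy-IsCoh Γ io γ (M⊢s⇒Fits dγ)))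
      (coh io (bulletΣr-⊢s (IsCoh⇒ps io) dγ))
  ΣrTm-⊢ {Γ} (conv {t = t} dt e) = subst (λ T → Σr₀ Γ ⊢ ΣrTm (nfTm Γ t) ∶ ΣrTy T) (nfTy-≣ty e) (ΣrTm-⊢ dt)

  ΣrTm-var-⊢ : ∀ {Γ} → Γ M⊢ → ∀ x A → mlookupCtx Γ x ≡ just A →
               Σr₀ Γ ⊢ ΣrTm (nfTm Γ (mvar x)) ∶ ΣrTy (nfTy Γ A)
  ΣrTm-var-⊢ {Γ} dΓ x 𝟙 eq rewrite has𝟙-lookup Γ x | eq = var (Σr₀-⊢ dΓ) (lookupCtx-ΣrCtx-0 (nfCtx Γ))
  ΣrTm-var-⊢ {Γ} dΓ x (MHom B t u) eq rewrite has𝟙-lookup Γ x | eq =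
    var (Σr₀-⊢ dΓ) (lookupCtx-Σr₀-suc dΓ x eq refl)

  bulletΣr-⊢s : ∀ {Γ γ Θ} → Θ ⊢ps → Γ M⊢s γ ∶ CtxM Θ → Σr₀ Γ ⊢s bulletΣr Γ Θ γ ∶ Θ
  bulletΣr-⊢s {Γ} {γ} {Θ} p dγ =
    bulletSub-∘-⊢s (ps⇒⊢ p) (ps⇒VarCtx p)
      (subst (Σr₀ Γ ⊢s_∶ Σr₀ (CtxM Θ))
        (ΣrSub-cong-cod (nfCtx (CtxM Θ)) (CtxM Θ) (nfSub Γ (CtxM Θ) γ) (Agree𝟙-nfCtx (CtxM Θ)))
        (Σr₁-⊢s dγ))

  Σr₁-⊢s : ∀ {Γ γ Δ} → Γ M⊢s γ ∶ Δ → Σr₀ Γ ⊢s Σr₁ Γ Δ γ ∶ Σr₀ Δ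
  Σr₁-⊢s {Γ} (⟨⟩ dΓ) = ext (⟨⟩ (Σr₀-⊢ dΓ)) (ext (⋆ ∅) (λ ())) (var (Σr₀-⊢ dΓ) (lookupCtx-ΣrCtx-0 (nfCtx Γ)))
  Σr₁-⊢s {Γ} (ext {Δ = Δ} {γ} {x} {𝟙} {t} dγ (ext _ x∉) _) = Σr₁-ext-𝟙-⊢s Γ Δ γ x t dγ x∉ (Σr₁-⊢s dγ)
  Σr₁-⊢s {Γ} (ext {Δ = Δ} {γ} {x} {MHom B u v} {t} dγ dΔ'@(ext dA x∉) dt) =
    Σr₁-ext-hom-⊢s Γ Δ γ x B u v t dγ dA x∉ (Σr₁-⊢s dγ) (Σr₀-⊢ dΔ') (ΣrTm-⊢ dt)

mainTheorem11 : IsFunctorΣr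
mainTheorem11 = Σr₀-⊢ , Σr₁-⊢s , Σr₁-resp-≣ , Σr₁-midSub , Σr₁-∘
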